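{- For every positive integer $n$, let $d=\gcd(4,n)$ and $\bar C_{4,n}(q)=[d]\,C_{4,n}(q)$. Then $\bar C_{4,n}(q)$ is a polynomial in $q$ that is unimodal with respect to parity. Equivalently, for every positive integer $n$, the Laurent polynomial $\mathrm{PT}_q\Big(\frac{q^d-q^{ -d}}{q-q^{ -1}}(q^2-q^{ -2})\,C_{4,n}(q^2)\,q^{ -3(n-1)}\Big)$ has nonnegative integer coefficients.
   Context: For a nonnegative integer $k$, $[k]=\frac{1-q^k}{1-q}$ and $[k]!=[k][k-1]\cdots[1]$ (with $[0]!=1$); $\begin{bmatrix} a+b\\ a\end{bmatrix}_q=\frac{[a+b]!}{[a]!\,[b]!}$. For positive integers $m,n$, $C_{m,n}(q)=\frac{1}{[m+n]}\begin{bmatrix} m+n\\ n\end{bmatrix}_q$. $\mathrm{PT}_q\sum_i a_iq^i=\sum_{i>0}a_iq^i$. A polynomial $a_0+a_1q+\dots+a_Nq^N$ is unimodal with respect to parity if both sequences $a_0,a_2,a_4,\dots$ and $a_1,a_3,a_5,\dots$ are unimodal, where a sequence $b_0,\dots,b_s$ is unimodal if $b_0\le\cdots\le b_j\ge b_{j+1}\ge\cdots\ge b_s$ for some $j$. -}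

module Defs where

open import Data.Nat as ℕ using (ℕ; zero; suc; _<_)
open import Data.Integer as ℤ using (ℤ; 0ℤ; 1ℤ; _≤_)
open import Data.List using (List; []; _∷_; _++_; [_]; length; replicate)
open import Data.Product using (Σ; ∃; _×_; _,_)
open import Data.Sum using (_⊎_)
open import Relation.Binary.PropositionalEquality using (_≡_; _≢_)

-- Polynomials in q with integer coefficients, as coefficient lists
-- (constant term first). Trailing zeros are allowed; equality is
-- coefficientwise (see _≈ₚ_).
Poly : Set
Poly = List ℤ

coeff : Poly → ℕ → ℤ
coeff []       _       = 0ℤ
coeff (a ∷ p)  zero    = a
coeff (a ∷ p)  (suc i) = coeff p i

_≈ₚ_ : Poly → Poly → Set
p ≈ₚ r = ∀ i → coeff p i ≡ coeff r i

infix 4 _≈ₚ_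
infixl 6 _+ₚ_
infixl 7 _*ₚ_

_+ₚ_ : Poly → Poly → Poly
[]      +ₚ r       = r
(a ∷ p) +ₚ []      = a ∷ p
(a ∷ p) +ₚ (b ∷ r) = (a ℤ.+ b) ∷ (p +ₚ r)

scale : ℤ → Poly → Poly
scale c []      = []
scale c (b ∷ r) = (c ℤ.* b) ∷ scale c r

_*ₚ_ : Poly → Poly → Poly
[]      *ₚ r = []
(a ∷ p) *ₚ r = scale a r +ₚ (0ℤ ∷ (p *ₚ r))

-- q-integer [k] = 1 + q + ... + q^(k-1)
qint : ℕ → Poly
qint k = replicate k 1ℤ

qfact : ℕ → Poly
qfact zero    = 1ℤ ∷ []
qfact (suc k) = qint (suc k) *ₚ qfact k

-- the polynomial is written with its exact degree:
-- empty, or the last (leading) coefficient is nonzero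
Normalized : Poly → Set
Normalized p = ∀ (xs : List ℤ) (x : ℤ) → p ≡ xs ++ [ x ] → x ≢ 0ℤ

mutual
  evens : List ℤ → List ℤ
  evens []       = []
  evens (x ∷ xs) = x ∷ odds xs

  odds : List ℤ → List ℤ
  odds []       = []
  odds (x ∷ xs) = evens xs

Unimodal : List ℤ → Set
Unimodal bs = ∃ λ (j : ℕ) →
  (∀ i → suc i ℕ.≤ j → suc i < length bs → coeff bs i ≤ coeff bs (suc i)) ×
  (∀ i → j ℕ.≤ i → suc i < length bs → coeff bs (suc i) ≤ coeff bs i)

UnimodalWrtParity : Poly → Set
UnimodalWrtParity p = Unimodal (evens p) × Unimodal (odds p)

-- P represents [d] · C_{m,n}(q) = [d] · (1/[m+n]) · [m+n]! / ([m]! [n]!),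
-- i.e. P · [m+n] · [m]! · [n]! = [d] · [m+n]!  as polynomials.
IsScaledQCatalan : ℕ → ℕ → ℕ → Poly → Set
IsScaledQCatalan d m n P =
  P *ₚ (qint (m ℕ.+ n) *ₚ (qfact m *ₚ qfact n)) ≈ₚ qint d *ₚ qfact (m ℕ.+ n)

module Submission where

open import Defs
open import Data.Nat using (ℕ; _≤_)
open import Data.Nat.GCD using (gcd)
open import Data.Product using (Σ; _×_)

-- X is characterised by the product identity [2][3][4] X = [d][n+1][n+2][n+3]
-- (CatalanIdentity).  Reading coefficient lists as power series (Series) and
-- multiplying by (1 - q)³ gives (1 - q²)(1 - q³)(1 - q⁴) X = [d] ∏ᵢ (1 - q^(n+i)).
-- Since a factor 1 - qᵃ can be cancelled on power series, this identity yields the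
-- degree 2c of X, its palindromicity, and (1 - q²) X = ∏ᵢ (1 - q^(n+i)) F for the
-- series F = [d] / ((1 - q³)(1 - q⁴)) (CoreArgument).  Below degree 2n + 3 the right
-- side is F(k) minus a three-term window sum of F, which is ≥ 0 up to degree c since
-- F, a quasi-polynomial of period 12, dominates its window sums; this is verified by
-- finite computation for d = 1, 2, 4 (DominatingSeries).  By antisymmetry, the
-- step-two differences a(k) - a(k - 2) change sign exactly once, at c + 1, which is
-- unimodality of both a₀, a₂, … and a₁, a₃, … (TruncationAndUnimodality).  Finally X
-- exists: [2][3][4] divides [d][n+1][n+2][n+3], by distributing the factors 2, 3, 4
-- (or 6 = 2·3, 12 = 3·4) over d, n+1, n+2, n+3 according to n mod 12 (CatalanQuotient).

module PolynomialAlgebra where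

  open import Data.Nat using (zero; suc)
  open import Data.Integer as ℤ using (ℤ; 0ℤ; 1ℤ)
  open import Data.Integer.Properties as ℤP using (+-identityˡ; +-identityʳ; *-zeroˡ; *-zeroʳ; *-identityˡ)
  open import Data.Integer.Solver using (module +-*-Solver)
  open +-*-Solver using (solve; _:+_; _:*_; _:=_)
  open import Data.List using ([]; _∷_)
  open import Level using (0ℓ)
  open import Algebra.Bundles using (CommutativeMonoid)
  open import Relation.Binary.Bundles using (Setoid)
  open import Relation.Binary.PropositionalEquality
  open import Data.Product using (_,_)

  -- As ≈ₚ unfolds to a function type, the polynomials in a ≈ₚ-proof cannot be
  -- inferred from its type, so congruence lemmas take them as explicit arguments.

  coeff-+ : ∀ p r i → coeff (p +ₚ r) i ≡ coeff p i ℤ.+ coeff r i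
  coeff-+ []      r       i       = sym (+-identityˡ _)
  coeff-+ (a ∷ p) []      i       = sym (+-identityʳ _)
  coeff-+ (a ∷ p) (b ∷ r) zero    = refl
  coeff-+ (a ∷ p) (b ∷ r) (suc i) = coeff-+ p r i

  coeff-scale : ∀ c r i → coeff (scale c r) i ≡ c ℤ.* coeff r i
  coeff-scale c []      i       = sym (*-zeroʳ c)
  coeff-scale c (b ∷ r) zero    = refl
  coeff-scale c (b ∷ r) (suc i) = coeff-scale c r i

  coeff-∷* : ∀ a p r i → coeff ((a ∷ p) *ₚ r) i ≡ a ℤ.* coeff r i ℤ.+ coeff (0ℤ ∷ (p *ₚ r)) i
  coeff-∷* a p r i = trans (coeff-+ (scale a r) _ i) (cong (ℤ._+ _) (coeff-scale a r i))

  ≈ₚ-setoid : Setoid 0ℓ 0ℓ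
  ≈ₚ-setoid = record
    { Carrier = Poly
    ; _≈_ = _≈ₚ_
    ; isEquivalence = record
      { refl = λ _ → refl
      ; sym = λ e i → sym (e i)
      ; trans = λ e f i → trans (e i) (f i) } }

  ∷-cong : ∀ a {p r} → p ≈ₚ r → a ∷ p ≈ₚ a ∷ r
  ∷-cong a e zero    = refl
  ∷-cong a e (suc i) = e i

  +ₚ-cong : ∀ p p′ r r′ → p ≈ₚ p′ → r ≈ₚ r′ → p +ₚ r ≈ₚ p′ +ₚ r′
  +ₚ-cong p p′ r r′ e f i =
    trans (coeff-+ p r i) (trans (cong₂ ℤ._+_ (e i) (f i)) (sym (coeff-+ p′ r′ i)))

  *ₚ-zeroˡ : ∀ p r → p ≈ₚ [] → p *ₚ r ≈ₚ []
  *ₚ-zeroˡ []      r e i       = refl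
  *ₚ-zeroˡ (a ∷ p) r e zero    = trans (coeff-∷* a p r zero) (cong (λ z → z ℤ.* coeff r 0 ℤ.+ 0ℤ) (e 0))
  *ₚ-zeroˡ (a ∷ p) r e (suc i) = trans (coeff-∷* a p r (suc i))
    (cong₂ (λ z w → z ℤ.* coeff r (suc i) ℤ.+ w) (e 0) (*ₚ-zeroˡ p r (λ j → e (suc j)) i))

  *ₚ-congˡ : ∀ p p′ r → p ≈ₚ p′ → p *ₚ r ≈ₚ p′ *ₚ r
  *ₚ-congˡ []      []       r e i = refl
  *ₚ-congˡ (a ∷ p) []       r e   = *ₚ-zeroˡ (a ∷ p) r e
  *ₚ-congˡ []      (b ∷ p′) r e i = sym (*ₚ-zeroˡ (b ∷ p′) r (λ j → sym (e j)) i)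
  *ₚ-congˡ (a ∷ p) (b ∷ p′) r e i = begin
    coeff ((a ∷ p) *ₚ r) i                    ≡⟨ coeff-∷* a p r i ⟩
    a ℤ.* coeff r i ℤ.+ coeff (0ℤ ∷ (p *ₚ r)) i
      ≡⟨ cong₂ (λ z w → z ℤ.* coeff r i ℤ.+ w) (e 0) (∷-cong 0ℤ (*ₚ-congˡ p p′ r (λ j → e (suc j))) i) ⟩
    b ℤ.* coeff r i ℤ.+ coeff (0ℤ ∷ (p′ *ₚ r)) i ≡⟨ coeff-∷* b p′ r i ⟨
    coeff ((b ∷ p′) *ₚ r) i                   ∎
    where open ≡-Reasoning

  *ₚ-congʳ : ∀ p r r′ → r ≈ₚ r′ → p *ₚ r ≈ₚ p *ₚ r′
  *ₚ-congʳ []      r r′ e i = refl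
  *ₚ-congʳ (a ∷ p) r r′ e i = begin
    coeff ((a ∷ p) *ₚ r) i                      ≡⟨ coeff-∷* a p r i ⟩
    a ℤ.* coeff r i ℤ.+ coeff (0ℤ ∷ (p *ₚ r)) i
      ≡⟨ cong₂ (λ z w → a ℤ.* z ℤ.+ w) (e i) (∷-cong 0ℤ (*ₚ-congʳ p r r′ e) i) ⟩
    a ℤ.* coeff r′ i ℤ.+ coeff (0ℤ ∷ (p *ₚ r′)) i ≡⟨ coeff-∷* a p r′ i ⟨
    coeff ((a ∷ p) *ₚ r′) i                     ∎
    where open ≡-Reasoning

  *ₚ-cong : ∀ p p′ r r′ → p ≈ₚ p′ → r ≈ₚ r′ → p *ₚ r ≈ₚ p′ *ₚ r′
  *ₚ-cong p p′ r r′ e f i = trans (*ₚ-congˡ p p′ r e i) (*ₚ-congʳ p′ r r′ f i)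

  *ₚ-zeroʳ : ∀ p → p *ₚ [] ≈ₚ []
  *ₚ-zeroʳ []      i       = refl
  *ₚ-zeroʳ (a ∷ p) zero    = refl
  *ₚ-zeroʳ (a ∷ p) (suc i) = *ₚ-zeroʳ p i

  *ₚ-comm : ∀ p r → p *ₚ r ≈ₚ r *ₚ p
  *ₚ-comm []      r     i = sym (*ₚ-zeroʳ r i)
  *ₚ-comm (a ∷ p) []      = *ₚ-zeroʳ (a ∷ p)
  *ₚ-comm (a ∷ p) (b ∷ r) zero =
    cong (ℤ._+ 0ℤ) (ℤP.*-comm a b)
  *ₚ-comm (a ∷ p) (b ∷ r) (suc i) = begin
    coeff ((a ∷ p) *ₚ (b ∷ r)) (suc i)           ≡⟨ coeff-∷* a p (b ∷ r) (suc i) ⟩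
    a ℤ.* coeff r i ℤ.+ coeff (p *ₚ (b ∷ r)) i
      ≡⟨ cong (λ z → a ℤ.* coeff r i ℤ.+ z) (trans (*ₚ-comm p (b ∷ r) i) (coeff-∷* b r p i)) ⟩
    a ℤ.* coeff r i ℤ.+ (b ℤ.* coeff p i ℤ.+ coeff (0ℤ ∷ (r *ₚ p)) i)
      ≡⟨ cong (λ z → a ℤ.* coeff r i ℤ.+ (b ℤ.* coeff p i ℤ.+ z)) (∷-cong 0ℤ (*ₚ-comm r p) i) ⟩
    a ℤ.* coeff r i ℤ.+ (b ℤ.* coeff p i ℤ.+ coeff (0ℤ ∷ (p *ₚ r)) i)
      ≡⟨ solve 3 (λ x y z → x :+ (y :+ z) := y :+ (x :+ z)) refl
           (a ℤ.* coeff r i) (b ℤ.* coeff p i) (coeff (0ℤ ∷ (p *ₚ r)) i) ⟩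
    b ℤ.* coeff p i ℤ.+ (a ℤ.* coeff r i ℤ.+ coeff (0ℤ ∷ (p *ₚ r)) i)
      ≡⟨ cong (λ z → b ℤ.* coeff p i ℤ.+ z) (trans (sym (*ₚ-comm (a ∷ p) r i)) (coeff-∷* a p r i)) ⟨
    b ℤ.* coeff p i ℤ.+ coeff (r *ₚ (a ∷ p)) i  ≡⟨ coeff-∷* b r (a ∷ p) (suc i) ⟨
    coeff ((b ∷ r) *ₚ (a ∷ p)) (suc i)           ∎
    where open ≡-Reasoning

  *ₚ-distribʳ : ∀ x y s → (x +ₚ y) *ₚ s ≈ₚ x *ₚ s +ₚ y *ₚ s
  *ₚ-distribʳ []      y       s i = refl
  *ₚ-distribʳ (a ∷ x) []      s i = sym (trans (coeff-+ ((a ∷ x) *ₚ s) [] i) (+-identityʳ _))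
  *ₚ-distribʳ (a ∷ x) (b ∷ y) s i = begin
    coeff (((a ℤ.+ b) ∷ (x +ₚ y)) *ₚ s) i
      ≡⟨ coeff-∷* (a ℤ.+ b) (x +ₚ y) s i ⟩
    (a ℤ.+ b) ℤ.* coeff s i ℤ.+ coeff (0ℤ ∷ ((x +ₚ y) *ₚ s)) i
      ≡⟨ cong (λ z → (a ℤ.+ b) ℤ.* coeff s i ℤ.+ z)
           (trans (∷-cong 0ℤ (*ₚ-distribʳ x y s) i) (coeff-+ (0ℤ ∷ (x *ₚ s)) (0ℤ ∷ (y *ₚ s)) i)) ⟩
    (a ℤ.+ b) ℤ.* coeff s i ℤ.+ (u ℤ.+ v)
      ≡⟨ solve 5 (λ a b c u v → (a :+ b) :* c :+ (u :+ v) := (a :* c :+ u) :+ (b :* c :+ v))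
           refl a b (coeff s i) u v ⟩
    (a ℤ.* coeff s i ℤ.+ u) ℤ.+ (b ℤ.* coeff s i ℤ.+ v)
      ≡⟨ cong₂ ℤ._+_ (coeff-∷* a x s i) (coeff-∷* b y s i) ⟨
    coeff ((a ∷ x) *ₚ s) i ℤ.+ coeff ((b ∷ y) *ₚ s) i
      ≡⟨ coeff-+ ((a ∷ x) *ₚ s) ((b ∷ y) *ₚ s) i ⟨
    coeff ((a ∷ x) *ₚ s +ₚ (b ∷ y) *ₚ s) i ∎
    where
    open ≡-Reasoning
    u v : ℤ
    u = coeff (0ℤ ∷ (x *ₚ s)) i
    v = coeff (0ℤ ∷ (y *ₚ s)) i

  0∷-*ₚ : ∀ x s → (0ℤ ∷ x) *ₚ s ≈ₚ 0ℤ ∷ (x *ₚ s)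
  0∷-*ₚ x s i = trans (coeff-∷* 0ℤ x s i)
    (trans (cong (ℤ._+ coeff (0ℤ ∷ (x *ₚ s)) i) (*-zeroˡ (coeff s i))) (+-identityˡ _))

  scale-*ₚ : ∀ a r s → scale a r *ₚ s ≈ₚ scale a (r *ₚ s)
  scale-*ₚ a []      s i = refl
  scale-*ₚ a (b ∷ r) s i = begin
    coeff ((a ℤ.* b ∷ scale a r) *ₚ s) i
      ≡⟨ coeff-∷* (a ℤ.* b) (scale a r) s i ⟩
    a ℤ.* b ℤ.* coeff s i ℤ.+ coeff (0ℤ ∷ (scale a r *ₚ s)) i
      ≡⟨ cong (λ z → a ℤ.* b ℤ.* coeff s i ℤ.+ z) (trans (∷-cong 0ℤ (scale-*ₚ a r s) i) (shifted i)) ⟩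
    a ℤ.* b ℤ.* coeff s i ℤ.+ a ℤ.* coeff (0ℤ ∷ (r *ₚ s)) i
      ≡⟨ solve 4 (λ a b c u → a :* b :* c :+ a :* u := a :* (b :* c :+ u))
           refl a b (coeff s i) (coeff (0ℤ ∷ (r *ₚ s)) i) ⟩
    a ℤ.* (b ℤ.* coeff s i ℤ.+ coeff (0ℤ ∷ (r *ₚ s)) i)
      ≡⟨ cong (a ℤ.*_) (coeff-∷* b r s i) ⟨
    a ℤ.* coeff ((b ∷ r) *ₚ s) i
      ≡⟨ coeff-scale a ((b ∷ r) *ₚ s) i ⟨
    coeff (scale a ((b ∷ r) *ₚ s)) i ∎
    where
    open ≡-Reasoning
    shifted : ∀ i → coeff (0ℤ ∷ scale a (r *ₚ s)) i ≡ a ℤ.* coeff (0ℤ ∷ (r *ₚ s)) i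
    shifted zero    = sym (*-zeroʳ a)
    shifted (suc i) = coeff-scale a (r *ₚ s) i

  *ₚ-assoc : ∀ p r s → (p *ₚ r) *ₚ s ≈ₚ p *ₚ (r *ₚ s)
  *ₚ-assoc []      r s i = refl
  *ₚ-assoc (a ∷ p) r s = begin
    (scale a r +ₚ (0ℤ ∷ (p *ₚ r))) *ₚ s
      ≈⟨ *ₚ-distribʳ (scale a r) (0ℤ ∷ (p *ₚ r)) s ⟩
    scale a r *ₚ s +ₚ (0ℤ ∷ (p *ₚ r)) *ₚ s
      ≈⟨ +ₚ-cong (scale a r *ₚ s) (scale a (r *ₚ s)) ((0ℤ ∷ (p *ₚ r)) *ₚ s) (0ℤ ∷ ((p *ₚ r) *ₚ s))
           (scale-*ₚ a r s) (0∷-*ₚ (p *ₚ r) s) ⟩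
    scale a (r *ₚ s) +ₚ (0ℤ ∷ ((p *ₚ r) *ₚ s))
      ≈⟨ +ₚ-cong (scale a (r *ₚ s)) (scale a (r *ₚ s)) (0ℤ ∷ ((p *ₚ r) *ₚ s)) (0ℤ ∷ (p *ₚ (r *ₚ s)))
           (λ _ → refl) (∷-cong 0ℤ (*ₚ-assoc p r s)) ⟩
    scale a (r *ₚ s) +ₚ (0ℤ ∷ (p *ₚ (r *ₚ s)))    ∎
    where open import Relation.Binary.Reasoning.Setoid ≈ₚ-setoid

  one : Poly
  one = 1ℤ ∷ []

  *ₚ-identityˡ : ∀ p → one *ₚ p ≈ₚ p
  *ₚ-identityˡ p i = trans (coeff-∷* 1ℤ [] p i)
                           (trans (cong₂ ℤ._+_ (*-identityˡ (coeff p i)) (zero-tail i)) (+-identityʳ _))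
    where
    zero-tail : ∀ i → coeff (0ℤ ∷ []) i ≡ 0ℤ
    zero-tail zero    = refl
    zero-tail (suc i) = refl

  *ₚ-identityʳ : ∀ p → p *ₚ one ≈ₚ p
  *ₚ-identityʳ p i = trans (*ₚ-comm p one i) (*ₚ-identityˡ p i)

  polyMonoid : CommutativeMonoid 0ℓ 0ℓ
  polyMonoid = record
    { Carrier = Poly
    ; _≈_ = _≈ₚ_
    ; _∙_ = _*ₚ_
    ; ε = one
    ; isCommutativeMonoid = record
      { isMonoid = record
        { isSemigroup = record
          { isMagma = record
            { isEquivalence = Setoid.isEquivalence ≈ₚ-setoid
            ; ∙-cong = λ {p} {p′} {r} {r′} → *ₚ-cong p p′ r r′ }
          ; assoc = *ₚ-assoc }
        ; identity = *ₚ-identityˡ , *ₚ-identityʳ }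
      ; comm = *ₚ-comm } }

module Series where

  open import Data.Nat as ℕ using (ℕ; zero; suc; _≤_; _<_; z≤n; s≤s)
  import Data.Nat.Properties as ℕP
  open import Data.Integer as ℤ using (ℤ; +_; -[1+_]; 0ℤ; 1ℤ; _+_; _-_; -_)
  open import Data.Integer.Properties
    using (+-identityˡ; +-identityʳ; +-assoc; +-inverseʳ; pos-+; [+m]-[+n]≡m⊖n; ⊖-≥; ⊖-<; i-j≡0⇒i≡j;
           neg-involutive; neg-injective; neg-mono-≤)
    renaming (≤-reflexive to ℤ-≤-reflexive)
  open import Data.Integer.Solver using (module +-*-Solver)
  open +-*-Solver using (solve; _:+_; :-_; _:-_; con; _:=_)
  open import Data.List using (List; []; _∷_; length; map)
  open import Data.Nat.ListAction using (sum)
  open import Data.List.Relation.Unary.All using (All; []; _∷_)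
  open import Data.Product using (Σ; _×_; _,_)
  open import Data.Sum using (inj₁; inj₂)
  open import Relation.Binary.PropositionalEquality
  open import Relation.Nullary using (yes; no)

  -- Integer sequences f : ℤ → ℤ stand for formal Laurent series Σ f(x) qˣ; the
  -- operators below are multiplications by polynomials in q, acting on coefficients.
  Seq : Set
  Seq = ℤ → ℤ

  infix 4 _≐_
  _≐_ : Seq → Seq → Set
  f ≐ g = ∀ x → f x ≡ g x

  ≐-trans : ∀ {f g h} → f ≐ g → g ≐ h → f ≐ h
  ≐-trans e₁ e₂ x = trans (e₁ x) (e₂ x)

  ≐-sym : ∀ {f g} → f ≐ g → g ≐ f
  ≐-sym e x = sym (e x)

  ext : (ℕ → ℤ) → Seq
  ext f (+ m)    = f m
  ext f -[1+ m ] = 0ℤ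

  -- f is a power series: no negative exponents.
  Causal : Seq → Set
  Causal f = ∀ m → f -[1+ m ] ≡ 0ℤ

  VanishesFrom : ℕ → Seq → Set
  VanishesFrom B f = ∀ m → B ≤ m → f (+ m) ≡ 0ℤ

  -- Multiplication by 1 - qᵃ.
  Δ : ℕ → Seq → Seq
  Δ a f x = f x - f (x - + a)

  -- Multiplication by [a] = 1 + q + ⋯ + q^(a-1).
  window : ℕ → Seq → Seq
  window zero    f x = 0ℤ
  window (suc a) f x = f x + window a f (x - 1ℤ)

  Δ* : List ℕ → Seq → Seq
  Δ* []       f = f
  Δ* (a ∷ as) f = Δ a (Δ* as f)

  window* : List ℕ → Seq → Seq
  window* []       f = f
  window* (a ∷ as) f = window a (window* as f)

  reflect : ℤ → Seq → Seq
  reflect M f x = f (M - x)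

  Palindromic : ℕ → Seq → Set
  Palindromic M f = reflect (+ M) f ≐ f

  sub-sub : ∀ x a b → (x - + a) - + b ≡ x - + (a ℕ.+ b)
  sub-sub x a b = trans (solve 3 (λ x a b → (x :- a) :- b := x :- (a :+ b)) refl x (+ a) (+ b))
                        (cong (λ z → x - z) (sym (pos-+ a b)))

  sub-swap : ∀ x a b → (x - + a) - + b ≡ (x - + b) - + a
  sub-swap x a b = trans (sub-sub x a b) (trans (cong (λ z → x - + z) (ℕP.+-comm a b)) (sym (sub-sub x b a)))

  negative-sub : ∀ m a → Σ ℕ (λ k → -[1+ m ] - + a ≡ -[1+ k ])
  negative-sub m zero    = m , refl
  negative-sub m (suc a) = suc (m ℕ.+ a) , refl

  sub-≥ : ∀ m a → a ≤ m → + m - + a ≡ + (m ℕ.∸ a)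
  sub-≥ m a a≤m = trans ([+m]-[+n]≡m⊖n m a) (⊖-≥ a≤m)

  sub-< : ∀ m a → m < a → Σ ℕ (λ k → + m - + a ≡ -[1+ k ])
  sub-< m a m<a = a ℕ.∸ m ℕ.∸ 1 , trans ([+m]-[+n]≡m⊖n m a) (trans (⊖-< m<a) (negate-pos (ℕP.m<n⇒0<n∸m m<a)))
    where
    negate-pos : ∀ {k} → 0 < k → - + k ≡ -[1+ k ℕ.∸ 1 ]
    negate-pos {suc k} _ = refl

  causal-< : ∀ f → Causal f → ∀ m a → m < a → f (+ m - + a) ≡ 0ℤ
  causal-< f cf m a m<a with sub-< m a m<a
  ... | k , eq = trans (cong f eq) (cf k)

  Δ-cong : ∀ a {f g} → f ≐ g → Δ a f ≐ Δ a g
  Δ-cong a e x = cong₂ _-_ (e x) (e (x - + a))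

  window-cong : ∀ a {f g} → f ≐ g → window a f ≐ window a g
  window-cong zero    e x = refl
  window-cong (suc a) e x = cong₂ _+_ (e x) (window-cong a e (x - 1ℤ))

  Δ*-cong : ∀ as {f g} → f ≐ g → Δ* as f ≐ Δ* as g
  Δ*-cong []       e = e
  Δ*-cong (a ∷ as) e = Δ-cong a (Δ*-cong as e)

  ext-causal : ∀ f → Causal (ext f)
  ext-causal f m = refl

  Δ-causal : ∀ a f → Causal f → Causal (Δ a f)
  Δ-causal a f cf m with negative-sub m a
  ... | k , eq rewrite eq | cf m | cf k = refl

  window-causal : ∀ a f → Causal f → Causal (window a f)
  window-causal zero    f cf m = refl
  window-causal (suc a) f cf m rewrite cf m = trans (+-identityˡ _) (window-causal a f cf (suc (m ℕ.+ 0)))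

  Δ*-causal : ∀ as f → Causal f → Causal (Δ* as f)
  Δ*-causal []       f cf = cf
  Δ*-causal (a ∷ as) f cf = Δ-causal a (Δ* as f) (Δ*-causal as f cf)

  -- Commutation: all these operators are multiplications by polynomials.

  Δ-comm : ∀ a b f → Δ a (Δ b f) ≐ Δ b (Δ a f)
  Δ-comm a b f x = begin
    (f x - f (x - + b)) - (f (x - + a) - f ((x - + a) - + b))
      ≡⟨ cong (λ z → (f x - f (x - + b)) - (f (x - + a) - f z)) (sub-swap x a b) ⟩
    (f x - f (x - + b)) - (f (x - + a) - f ((x - + b) - + a))
      ≡⟨ solve 4 (λ p q r s → (p :- q) :- (r :- s) := (p :- r) :- (q :- s)) refl
           (f x) (f (x - + b)) (f (x - + a)) (f ((x - + b) - + a)) ⟩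
    (f x - f (x - + a)) - (f (x - + b) - f ((x - + b) - + a)) ∎
    where open ≡-Reasoning

  Δ-window-comm : ∀ a b f → Δ a (window b f) ≐ window b (Δ a f)
  Δ-window-comm a zero    f x = refl
  Δ-window-comm a (suc b) f x = begin
    (f x + window b f (x - 1ℤ)) - (f (x - + a) + window b f ((x - + a) - 1ℤ))
      ≡⟨ cong (λ z → (f x + window b f (x - 1ℤ)) - (f (x - + a) + window b f z)) (sub-swap x a 1) ⟩
    (f x + window b f (x - 1ℤ)) - (f (x - + a) + window b f ((x - 1ℤ) - + a))
      ≡⟨ solve 4 (λ p q r s → (p :+ q) :- (r :+ s) := (p :- r) :+ (q :- s)) refl
           (f x) (window b f (x - 1ℤ)) (f (x - + a)) (window b f ((x - 1ℤ) - + a)) ⟩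
    (f x - f (x - + a)) + Δ a (window b f) (x - 1ℤ)
      ≡⟨ cong (λ z → (f x - f (x - + a)) + z) (Δ-window-comm a b f (x - 1ℤ)) ⟩
    (f x - f (x - + a)) + window b (Δ a f) (x - 1ℤ) ∎
    where open ≡-Reasoning

  Δ-Δ*-comm : ∀ a as f → Δ a (Δ* as f) ≐ Δ* as (Δ a f)
  Δ-Δ*-comm a []       f = λ _ → refl
  Δ-Δ*-comm a (b ∷ as) f = ≐-trans (Δ-comm a b (Δ* as f)) (Δ-cong b (Δ-Δ*-comm a as f))

  Δ*-comm : ∀ as bs f → Δ* as (Δ* bs f) ≐ Δ* bs (Δ* as f)
  Δ*-comm as []       f = λ _ → refl
  Δ*-comm as (b ∷ bs) f =
    ≐-trans (≐-sym (Δ-Δ*-comm b as (Δ* bs f))) (Δ-cong b (Δ*-comm as bs f))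

  window-Δ*-comm : ∀ a as f → window a (Δ* as f) ≐ Δ* as (window a f)
  window-Δ*-comm a []       f = λ _ → refl
  window-Δ*-comm a (b ∷ as) f =
    ≐-trans (≐-sym (Δ-window-comm b a (Δ* as f))) (Δ-cong b (window-Δ*-comm a as f))

  Δ1-window : ∀ a f → Δ 1 (window a f) ≐ Δ a f
  Δ1-window zero    f x = sym (trans (cong (λ z → f x - f z) (+-identityʳ x)) (+-inverseʳ (f x)))
  Δ1-window (suc a) f x = begin
    (f x + window a f (x - 1ℤ)) - (f (x - 1ℤ) + window a f ((x - 1ℤ) - 1ℤ))
      ≡⟨ solve 4 (λ p q r s → (p :+ q) :- (r :+ s) := (p :- r) :+ (q :- s)) refl
           (f x) (window a f (x - 1ℤ)) (f (x - 1ℤ)) (window a f ((x - 1ℤ) - 1ℤ)) ⟩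
    (f x - f (x - 1ℤ)) + Δ 1 (window a f) (x - 1ℤ)
      ≡⟨ cong (λ z → (f x - f (x - 1ℤ)) + z) (Δ1-window a f (x - 1ℤ)) ⟩
    (f x - f (x - 1ℤ)) + (f (x - 1ℤ) - f ((x - 1ℤ) - + a))
      ≡⟨ solve 3 (λ p q r → (p :- q) :+ (q :- r) := p :- r) refl (f x) (f (x - 1ℤ)) (f ((x - 1ℤ) - + a)) ⟩
    f x - f ((x - 1ℤ) - + a)
      ≡⟨ cong (λ z → f x - f z) (sub-sub x 1 a) ⟩
    f x - f (x - + suc a) ∎
    where open ≡-Reasoning

  Δ1s-window* : ∀ as f → Δ* (map (λ _ → 1) as) (window* as f) ≐ Δ* as f
  Δ1s-window* []       f = λ _ → refl
  Δ1s-window* (a ∷ as) f =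
    ≐-trans (Δ-cong 1 (≐-sym (window-Δ*-comm a (map (λ _ → 1) as) (window* as f))))
    (≐-trans (Δ1-window a (Δ* (map (λ _ → 1) as) (window* as f)))
             (Δ-cong a (Δ1s-window* as f)))

  Δ-sub : ∀ a f g → Δ a (λ x → f x - g x) ≐ λ x → Δ a f x - Δ a g x
  Δ-sub a f g x = solve 4 (λ p q r s → (p :- q) :- (r :- s) := (p :- r) :- (q :- s)) refl
    (f x) (g x) (f (x - + a)) (g (x - + a))

  Δ*-sub : ∀ as f g → Δ* as (λ x → f x - g x) ≐ λ x → Δ* as f x - Δ* as g x
  Δ*-sub []       f g = λ _ → refl
  Δ*-sub (a ∷ as) f g = ≐-trans (Δ-cong a (Δ*-sub as f g)) (Δ-sub a (Δ* as f) (Δ* as g))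

  -- Multiplication by 1 - qᵃ (a > 0) has trivial kernel on power series: g(m) = g(m - a)
  -- reduces m until it becomes negative.  (Recursion on an explicit bound, since
  -- m - a is not a structural subterm of m.)
  Δ-kernel : ∀ a g → Causal g → Δ (suc a) g ≐ (λ _ → 0ℤ) → g ≐ (λ _ → 0ℤ)
  Δ-kernel a g cg e -[1+ m ] = cg m
  Δ-kernel a g cg e (+ m)    = go (suc m) m (ℕP.n<1+n m)
    where
    step : ∀ m → g (+ m) ≡ g (+ m - + suc a)
    step m = i-j≡0⇒i≡j _ _ (e (+ m))
    go : ∀ fuel m → m < fuel → g (+ m) ≡ 0ℤ
    go (suc fuel) m (s≤s m≤fuel) with m ℕP.<? suc a
    ... | yes m<a = trans (step m) (causal-< g cg m (suc a) m<a)
    ... | no  m≮a = trans (step m) (trans (cong g (sub-≥ m (suc a) (ℕP.≮⇒≥ m≮a)))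
                     (go fuel (m ℕ.∸ suc a)
                         (ℕP.<-≤-trans (ℕP.∸-monoʳ-< {m} {suc a} {0} (s≤s z≤n) (ℕP.≮⇒≥ m≮a)) m≤fuel)))

  Positive : ℕ → Set
  Positive a = 0 < a

  Δ*-kernel : ∀ as g → All Positive as → Causal g → Δ* as g ≐ (λ _ → 0ℤ) → g ≐ (λ _ → 0ℤ)
  Δ*-kernel []            g []               cg e = e
  Δ*-kernel (suc a ∷ as) g (s≤s z≤n ∷ pos) cg e =
    Δ*-kernel as g pos cg (Δ-kernel a (Δ* as g) (Δ*-causal as g cg) e)

  Δ*-cancel : ∀ as {f g} → All Positive as → Causal f → Causal g → Δ* as f ≐ Δ* as g → f ≐ g
  Δ*-cancel as {f} {g} pos cf cg e x =
    i-j≡0⇒i≡j _ _ (Δ*-kernel as (λ y → f y - g y) pos difference-causal difference-vanishes x)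
    where
    difference-causal : Causal (λ y → f y - g y)
    difference-causal m rewrite cf m | cg m = refl
    difference-vanishes : Δ* as (λ y → f y - g y) ≐ (λ _ → 0ℤ)
    difference-vanishes y = trans (Δ*-sub as f g y)
      (trans (cong (λ z → z - Δ* as g y) (e y)) (+-inverseʳ (Δ* as g y)))

  vanishes-≡ : ∀ {B B′} g → B ≡ B′ → VanishesFrom B g → VanishesFrom B′ g
  vanishes-≡ g refl v = v

  Δ-vanishes : ∀ a B g → VanishesFrom B g → VanishesFrom (B ℕ.+ a) (Δ a g)
  Δ-vanishes a B g v m B+a≤m = begin
    g (+ m) - g (+ m - + a)          ≡⟨ cong₂ (λ u w → u - g w) (v m (ℕP.≤-trans (ℕP.m≤m+n B a) B+a≤m))
                                                               (sub-≥ m a (ℕP.≤-trans (ℕP.m≤n+m a B) B+a≤m)) ⟩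
    0ℤ - g (+ (m ℕ.∸ a))             ≡⟨ cong (λ z → 0ℤ - z) (v (m ℕ.∸ a) B≤m∸a) ⟩
    0ℤ                               ∎
    where
    open ≡-Reasoning
    B≤m∸a : B ≤ m ℕ.∸ a
    B≤m∸a = ℕP.≤-trans (ℕP.≤-reflexive (sym (ℕP.m+n∸n≡m B a))) (ℕP.∸-monoˡ-≤ a B+a≤m)

  Δ*-vanishes : ∀ as B g → VanishesFrom B g → VanishesFrom (B ℕ.+ sum as) (Δ* as g)
  Δ*-vanishes []       B g v = vanishes-≡ g (sym (ℕP.+-identityʳ B)) v
  Δ*-vanishes (a ∷ as) B g v =
    vanishes-≡ (Δ a (Δ* as g)) (trans (ℕP.+-assoc B (sum as) a) (cong (B ℕ.+_) (ℕP.+-comm (sum as) a)))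
    (Δ-vanishes a (B ℕ.+ sum as) (Δ* as g) (Δ*-vanishes as B g v))

  Δ-vanishes-down : ∀ a L B g → VanishesFrom L g → VanishesFrom (B ℕ.+ suc a) (Δ (suc a) g) → VanishesFrom B g
  Δ-vanishes-down a L B g vL vΔ m B≤m = go L m B≤m (ℕP.m≤n+m L m)
    where
    -- g(m) = g(m + a + 1) = g(m + 2(a + 1)) = ⋯ eventually reaches the region beyond L
    go : ∀ k m → B ≤ m → L ≤ m ℕ.+ k → g (+ m) ≡ 0ℤ
    go zero    m B≤m L≤m = vL m (ℕP.≤-trans L≤m (ℕP.≤-reflexive (ℕP.+-identityʳ m)))
    go (suc k) m B≤m L≤m+k = begin
      g (+ m)                           ≡⟨ cong g shifted ⟨
      g (+ (m ℕ.+ suc a) - + suc a)     ≡⟨ i-j≡0⇒i≡j _ _ (vΔ (m ℕ.+ suc a) (ℕP.+-monoˡ-≤ (suc a) B≤m)) ⟨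
      g (+ (m ℕ.+ suc a))               ≡⟨ go k (m ℕ.+ suc a) (ℕP.≤-trans B≤m (ℕP.m≤m+n m (suc a))) L≤ ⟩
      0ℤ                                ∎
      where
      open ≡-Reasoning
      shifted : + (m ℕ.+ suc a) - + suc a ≡ + m
      shifted = trans (sub-≥ (m ℕ.+ suc a) (suc a) (ℕP.m≤n+m (suc a) m)) (cong +_ (ℕP.m+n∸n≡m m (suc a)))
      L≤ : L ≤ m ℕ.+ suc a ℕ.+ k
      L≤ = ℕP.≤-trans L≤m+k (ℕP.≤-trans (ℕP.+-monoʳ-≤ m (s≤s (ℕP.m≤n+m k a)))
                                        (ℕP.≤-reflexive (sym (ℕP.+-assoc m (suc a) k))))

  Δ*-vanishes-down : ∀ as L B g → All Positive as → VanishesFrom L g →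
    VanishesFrom (B ℕ.+ sum as) (Δ* as g) → VanishesFrom B g
  Δ*-vanishes-down []           L B g []               vL vΔ = vanishes-≡ g (ℕP.+-identityʳ B) vΔ
  Δ*-vanishes-down (suc a ∷ as) L B g (s≤s z≤n ∷ pos) vL vΔ =
    Δ*-vanishes-down as L B g pos vL
      (Δ-vanishes-down a (L ℕ.+ sum as) (B ℕ.+ sum as) (Δ* as g) (Δ*-vanishes as L g vL)
        (vanishes-≡ (Δ* (suc a ∷ as) g) (sym (trans (ℕP.+-assoc B (sum as) (suc a))
                                                    (cong (B ℕ.+_) (ℕP.+-comm (sum as) (suc a))))) vΔ))

  -- k-fold negation, the sign picked up by reflecting a product of k factors 1 - qᵃ.
  negate^ : ℕ → ℤ → ℤ
  negate^ zero    z = z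
  negate^ (suc k) z = - negate^ k z

  negate^-injective : ∀ k {u v} → negate^ k u ≡ negate^ k v → u ≡ v
  negate^-injective zero    e = e
  negate^-injective (suc k) e = negate^-injective k (neg-injective e)

  Δ-negate^ : ∀ a k f → Δ a (λ x → negate^ k (f x)) ≐ λ x → negate^ k (Δ a f x)
  Δ-negate^ a zero    f x = refl
  Δ-negate^ a (suc k) f x = trans (solve 2 (λ p q → (:- p) :- (:- q) := :- (p :- q)) refl
                                     (negate^ k (f x)) (negate^ k (f (x - + a))))
                                  (cong -_ (Δ-negate^ a k f x))

  Δ-reflect : ∀ a M f → reflect (M + + a) (Δ a f) ≐ λ x → - Δ a (reflect M f) x
  Δ-reflect a M f x = begin
    f (M + + a - x) - f (M + + a - x - + a)
      ≡⟨ cong₂ (λ u w → f u - f w) (solve 3 (λ M a x → M :+ a :- x := M :- (x :- a)) refl M (+ a) x)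
                                   (solve 3 (λ M a x → M :+ a :- x :- a := M :- x) refl M (+ a) x) ⟩
    f (M - (x - + a)) - f (M - x)
      ≡⟨ solve 2 (λ p q → p :- q := :- (q :- p)) refl (f (M - (x - + a))) (f (M - x)) ⟩
    - (f (M - x) - f (M - (x - + a))) ∎
    where open ≡-Reasoning

  Δ*-reflect : ∀ as M f → reflect (M + + sum as) (Δ* as f) ≐ λ x → negate^ (length as) (Δ* as (reflect M f) x)
  Δ*-reflect []       M f x = cong (λ c → f (c - x)) (+-identityʳ M)
  Δ*-reflect (a ∷ as) M f x = begin
    Δ a (Δ* as f) (M + + (a ℕ.+ sum as) - x)
      ≡⟨ cong (λ c → Δ a (Δ* as f) (c - x)) centre ⟩
    reflect (M + + sum as + + a) (Δ a (Δ* as f)) x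
      ≡⟨ Δ-reflect a (M + + sum as) (Δ* as f) x ⟩
    - Δ a (reflect (M + + sum as) (Δ* as f)) x
      ≡⟨ cong -_ (Δ-cong a (Δ*-reflect as M f) x) ⟩
    - Δ a (λ y → negate^ (length as) (Δ* as (reflect M f) y)) x
      ≡⟨ cong -_ (Δ-negate^ a (length as) (Δ* as (reflect M f)) x) ⟩
    negate^ (suc (length as)) (Δ* (a ∷ as) (reflect M f) x) ∎
    where
    open ≡-Reasoning
    centre : M + + (a ℕ.+ sum as) ≡ M + + sum as + + a
    centre = trans (cong (λ z → M + z) (trans (cong +_ (ℕP.+-comm a (sum as))) (pos-+ (sum as) a)))
                   (sym (+-assoc M (+ sum as) (+ a)))

  reflect-causal : ∀ N g → VanishesFrom (suc N) g → Causal (reflect (+ N) g)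
  reflect-causal N g v m =
    v (N ℕ.+ suc m) (ℕP.≤-trans (s≤s (ℕP.m≤m+n N m)) (ℕP.≤-reflexive (sym (ℕP.+-suc N m))))

  palindromic-transfer : ∀ as bs N M g h → All Positive as → length as ≡ length bs →
    N ℕ.+ sum as ≡ M ℕ.+ sum bs → Causal g → VanishesFrom (suc N) g → Palindromic M h →
    Δ* as g ≐ Δ* bs h → Palindromic N g
  palindromic-transfer as bs N M g h pos same-length centres cg vg pal-h e =
    Δ*-cancel as pos (reflect-causal N g vg) cg reflected
    where
    reflected : Δ* as (reflect (+ N) g) ≐ Δ* as g
    reflected x = negate^-injective (length as) (begin
      negate^ (length as) (Δ* as (reflect (+ N) g) x)    ≡⟨ Δ*-reflect as (+ N) g x ⟨
      reflect (+ (N ℕ.+ sum as)) (Δ* as g) x              ≡⟨ cong (λ c → Δ* as g (+ c - x)) centres ⟩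
      Δ* as g (+ (M ℕ.+ sum bs) - x)                     ≡⟨ e (+ (M ℕ.+ sum bs) - x) ⟩
      reflect (+ (M ℕ.+ sum bs)) (Δ* bs h) x              ≡⟨ Δ*-reflect bs (+ M) h x ⟩
      negate^ (length bs) (Δ* bs (reflect (+ M) h) x)
        ≡⟨ cong (λ k → negate^ k (Δ* bs (reflect (+ M) h) x)) same-length ⟨
      negate^ (length as) (Δ* bs (reflect (+ M) h) x)    ≡⟨ cong (negate^ (length as)) (Δ*-cong bs pal-h x) ⟩
      negate^ (length as) (Δ* bs h x)                    ≡⟨ cong (negate^ (length as)) (e x) ⟨
      negate^ (length as) (Δ* as g x)                    ∎)
      where open ≡-Reasoning

  Δ*-constant-term : ∀ as f → All Positive as → Causal f → Δ* as f (+ 0) ≡ f (+ 0)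
  Δ*-constant-term []           f []               cf = refl
  Δ*-constant-term (suc a ∷ as) f (s≤s z≤n ∷ pos) cf =
    trans (cong (λ z → Δ* as f (+ 0) - z) (Δ*-causal as f cf a))
          (trans (+-identityʳ _) (Δ*-constant-term as f pos cf))

  -- Below degree min(a + b, a + e, b + e), (1 - qᵃ)(1 - qᵇ)(1 - qᵉ) acts as 1 - qᵃ - qᵇ - qᵉ:
  -- the inclusion–exclusion terms of degree ≥ two steps vanish.
  Δ³-low-degree : ∀ a b e f → Causal f → ∀ k → k < a ℕ.+ b → k < a ℕ.+ e → k < b ℕ.+ e →
    Δ a (Δ b (Δ e f)) (+ k) ≡ f (+ k) - (f (+ k - + a) + f (+ k - + b) + f (+ k - + e))
  Δ³-low-degree a b e f cf k k<ab k<ae k<be = begin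
    Δ a (Δ b (Δ e f)) x     ≡⟨ inclusion-exclusion ⟩
    f x - single + double   ≡⟨ cong (λ z → f x - single + z) double≡0 ⟩
    f x - single + 0ℤ       ≡⟨ +-identityʳ _ ⟩
    f x - single            ∎
    where
    open ≡-Reasoning
    x single double : ℤ
    x = + k
    single = f (x - + a) + f (x - + b) + f (x - + e)
    double = f (x - + a - + b) + f (x - + a - + e) + f (x - + b - + e) - f (x - + a - + b - + e)
    inclusion-exclusion : Δ a (Δ b (Δ e f)) x ≡ f x - single + double
    inclusion-exclusion =
      solve 8 (λ p pa pb pe pab pae pbe pabe →
                 (p :- pe :- (pb :- pbe)) :- (pa :- pae :- (pab :- pabe))
                 := p :- (pa :+ pb :+ pe) :+ (pab :+ pae :+ pbe :- pabe))
        refl (f x) (f (x - + a)) (f (x - + b)) (f (x - + e))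
             (f (x - + a - + b)) (f (x - + a - + e)) (f (x - + b - + e)) (f (x - + a - + b - + e))
    vanish : ∀ u v → k < u ℕ.+ v → f (x - + u - + v) ≡ 0ℤ
    vanish u v k<uv = trans (cong f (sub-sub x u v)) (causal-< f cf k (u ℕ.+ v) k<uv)
    vanish₃ : f (x - + a - + b - + e) ≡ 0ℤ
    vanish₃ = trans (cong f (sub-sub (x - + a) b e))
                    (vanish a (b ℕ.+ e) (ℕP.<-≤-trans k<ab (ℕP.+-monoʳ-≤ a (ℕP.m≤m+n b e))))
    double≡0 : double ≡ 0ℤ
    double≡0 = cong₂ _-_ (cong₂ _+_ (cong₂ _+_ (vanish a b k<ab) (vanish a e k<ae)) (vanish b e k<be)) vanish₃

  Δ-consecutive-low-degree : ∀ n f → Causal f → ∀ k → k < suc n ℕ.+ suc (suc n) →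
    Δ* (suc n ∷ suc (suc n) ∷ suc (suc (suc n)) ∷ []) f (+ k) ≡ f (+ k) - window 3 f (+ k - + suc n)
  Δ-consecutive-low-degree n f cf k k<2n+3 = begin
    Δ (suc n) (Δ (suc (suc n)) (Δ (suc (suc (suc n))) f)) (+ k)
      ≡⟨ Δ³-low-degree (suc n) (suc (suc n)) (suc (suc (suc n))) f cf k k<2n+3
           (ℕP.<-≤-trans k<2n+3 (ℕP.+-monoʳ-≤ (suc n) (ℕP.n≤1+n (suc (suc n)))))
           (ℕP.<-≤-trans k<2n+3 (ℕP.+-mono-≤ (ℕP.n≤1+n (suc n)) (ℕP.n≤1+n (suc (suc n))))) ⟩
    f x - (f (x - + suc n) + f (x - + suc (suc n)) + f (x - + suc (suc (suc n))))
      ≡⟨ cong (λ w → f x - w) (cong₂ _+_ (cong (λ w → f y + w) (cong f second)) (cong f third)) ⟩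
    f x - (f y + f (y - 1ℤ) + f ((y - 1ℤ) - 1ℤ))
      ≡⟨ cong (λ w → f x - w) (solve 3 (λ p q r → p :+ q :+ r := p :+ (q :+ (r :+ con 0ℤ))) refl
                                (f y) (f (y - 1ℤ)) (f ((y - 1ℤ) - 1ℤ))) ⟩
    f x - window 3 f y ∎
    where
    open ≡-Reasoning
    x y : ℤ
    x = + k
    y = x - + suc n
    one-more : ∀ m → x - + suc m ≡ (x - + m) - 1ℤ
    one-more m = sym (trans (sub-sub x m 1) (cong (λ i → x - + i) (ℕP.+-comm m 1)))
    second : x - + suc (suc n) ≡ y - 1ℤ
    second = one-more (suc n)
    third : x - + suc (suc (suc n)) ≡ (y - 1ℤ) - 1ℤ
    third = trans (one-more (suc (suc n))) (cong (λ z → z - 1ℤ) second)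

  antisymmetric-sign : ∀ m D → Causal D → reflect (+ (m ℕ.+ m)) D ≐ (λ x → - D x) →
    (∀ k → k < m → 0ℤ ℤ.≤ D (+ k)) →
    (∀ k → k ≤ m → 0ℤ ℤ.≤ D (+ k)) × (∀ k → m ≤ k → D (+ k) ℤ.≤ 0ℤ)
  antisymmetric-sign m D cD anti below = up-to-m , from-m
    where
    flip : ∀ k → D (+ k) ≡ - D (+ (m ℕ.+ m) - + k)
    flip k = trans (sym (neg-involutive _)) (cong -_ (sym (anti (+ k))))
    at-m : D (+ m) ≡ 0ℤ
    at-m = self-negative (trans (flip m) (cong (λ i → - D i) 2m-m))
      where
      2m-m : + (m ℕ.+ m) - + m ≡ + m
      2m-m = trans (sub-≥ (m ℕ.+ m) m (ℕP.m≤n+m m m)) (cong +_ (ℕP.m+n∸n≡m m m))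
      self-negative : ∀ {z} → z ≡ - z → z ≡ 0ℤ
      self-negative {+ zero}   _  = refl
      self-negative {+ suc _}  ()
      self-negative { -[1+ _ ]} ()
    up-to-m : ∀ k → k ≤ m → 0ℤ ℤ.≤ D (+ k)
    up-to-m k k≤m with ℕP.m≤n⇒m<n∨m≡n k≤m
    ... | inj₁ k<m  = below k k<m
    ... | inj₂ refl = ℤ-≤-reflexive (sym at-m)
    from-m : ∀ k → m ≤ k → D (+ k) ℤ.≤ 0ℤ
    from-m k m≤k with k ℕP.≤? m ℕ.+ m
    ... | yes k≤2m = subst (ℤ._≤ 0ℤ) (sym (trans (flip k) (cong (λ i → - D i) (sub-≥ (m ℕ.+ m) k k≤2m))))
                       (neg-mono-≤ (up-to-m (m ℕ.+ m ℕ.∸ k) mirror≤m))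
      where
      mirror≤m : m ℕ.+ m ℕ.∸ k ≤ m
      mirror≤m = ℕP.≤-trans (ℕP.∸-monoʳ-≤ (m ℕ.+ m) m≤k) (ℕP.≤-reflexive (ℕP.m+n∸n≡m m m))
    ... | no k≰2m with sub-< (m ℕ.+ m) k (ℕP.≰⇒> k≰2m)
    ...   | j , eq = ℤ-≤-reflexive (trans (flip k) (trans (cong (λ i → - D i) eq) (cong -_ (cD j))))

module CoefficientSeries where

  open PolynomialAlgebra
  open Series
  open import Data.Nat as ℕ using (ℕ; zero; suc; _<_; s≤s)
  import Data.Nat.Properties as ℕP
  open import Data.Integer as ℤ using (+_; -[1+_]; 1ℤ; _+_)
  open import Data.Integer.Properties using (*-identityˡ)
  open import Data.List using (List; []; _∷_; length)
  open import Data.Product using (_,_)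
  open import Relation.Binary.PropositionalEquality
  open import Relation.Nullary using (yes; no)

  seq : Poly → Seq
  seq p = ext (coeff p)

  seq-≈ : ∀ p r → p ≈ₚ r → seq p ≐ seq r
  seq-≈ p r e (+ m)    = e m
  seq-≈ p r e -[1+ m ] = refl

  seq-vanishes : ∀ p → VanishesFrom (length p) (seq p)
  seq-vanishes []      m       _         = refl
  seq-vanishes (x ∷ p) (suc m) (s≤s len≤m) = seq-vanishes p m len≤m

  qprod : List ℕ → Poly → Poly
  qprod []       Y = Y
  qprod (a ∷ as) Y = qint a *ₚ qprod as Y

  seq-qint* : ∀ a Y → seq (qint a *ₚ Y) ≐ window a (seq Y)
  seq-qint* zero    Y (+ m)    = refl
  seq-qint* zero    Y -[1+ m ] = refl
  seq-qint* (suc a) Y -[1+ m ] = sym (window-causal (suc a) (seq Y) (ext-causal (coeff Y)) m)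
  seq-qint* (suc a) Y (+ zero) =
    trans (coeff-∷* 1ℤ (qint a) Y 0)
          (cong₂ _+_ (*-identityˡ (coeff Y 0)) (sym (window-causal a (seq Y) (ext-causal (coeff Y)) 0)))
  seq-qint* (suc a) Y (+ suc m) =
    trans (coeff-∷* 1ℤ (qint a) Y (suc m)) (cong₂ _+_ (*-identityˡ (coeff Y (suc m))) (seq-qint* a Y (+ m)))

  seq-qprod : ∀ as Y → seq (qprod as Y) ≐ window* as (seq Y)
  seq-qprod []       Y = λ _ → refl
  seq-qprod (a ∷ as) Y = ≐-trans (seq-qint* a (qprod as Y)) (window-cong a (seq-qprod as Y))

  coeff-qint-< : ∀ a k → k < a → coeff (qint a) k ≡ 1ℤ
  coeff-qint-< (suc a) zero    _         = refl
  coeff-qint-< (suc a) (suc k) (s≤s k<a) = coeff-qint-< a k k<a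

  qint-vanishes : ∀ a → VanishesFrom a (seq (qint a))
  qint-vanishes zero    m       _         = refl
  qint-vanishes (suc a) (suc m) (s≤s a≤m) = qint-vanishes a m a≤m

  qint-palindromic : ∀ d′ → Palindromic d′ (seq (qint (suc d′)))
  qint-palindromic d′ -[1+ k ] =
    qint-vanishes (suc d′) (d′ ℕ.+ suc k) (ℕP.≤-trans (s≤s (ℕP.m≤m+n d′ k)) (ℕP.≤-reflexive (sym (ℕP.+-suc d′ k))))
  qint-palindromic d′ (+ m) with m ℕP.≤? d′
  ... | yes m≤d′ = trans (cong (seq (qint (suc d′))) (sub-≥ d′ m m≤d′))
                         (trans (coeff-qint-< (suc d′) (d′ ℕ.∸ m) (s≤s (ℕP.m∸n≤m d′ m)))
                                (sym (coeff-qint-< (suc d′) m (s≤s m≤d′))))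
  ... | no m≰d′ with sub-< d′ m (ℕP.≰⇒> m≰d′)
  ...   | k , eq = trans (cong (seq (qint (suc d′))) eq) (sym (qint-vanishes (suc d′) m (ℕP.≰⇒> m≰d′)))

module TruncationAndUnimodality where

  open Series using (VanishesFrom)
  open CoefficientSeries using (seq)
  open import Data.Nat as ℕ using (ℕ; zero; suc; _≤_; _<_; z≤n; s≤s; _∸_)
  import Data.Nat.Properties as ℕP
  open import Data.Integer as ℤ using (0ℤ)
  open import Data.List using ([]; _∷_; take; [_]; length)
  open import Data.List.Properties using (∷-injective; ++-conicalʳ)
  open import Data.Product using (Σ; _×_; _,_; proj₁; proj₂)
  open import Relation.Binary.PropositionalEquality hiding ([_])
  open import Relation.Nullary using (yes; no)

  take-≈ : ∀ N X → VanishesFrom (suc N) (seq X) → take (suc N) X ≈ₚ X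
  take-≈ N X v i with i ℕP.<? suc N
  ... | yes i<N = coeff-take X i i<N
    where
    coeff-take : ∀ {k} X i → i < k → coeff (take k X) i ≡ coeff X i
    coeff-take {suc k} []      i       _         = refl
    coeff-take {suc k} (x ∷ X) zero    _         = refl
    coeff-take {suc k} (x ∷ X) (suc i) (s≤s i<k) = coeff-take X i i<k
  ... | no i≮N = trans (beyond-take X i (ℕP.≮⇒≥ i≮N)) (sym (v i (ℕP.≮⇒≥ i≮N)))
    where
    beyond-take : ∀ {k} X i → k ≤ i → coeff (take k X) i ≡ 0ℤ
    beyond-take {zero}  X       i       _         = refl
    beyond-take {suc k} []      i       _         = refl
    beyond-take {suc k} (x ∷ X) (suc i) (s≤s k≤i) = beyond-take X i k≤i

  take-normalized : ∀ N X → coeff X N ≢ 0ℤ → Normalized (take (suc N) X)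
  take-normalized N       []      c≢0 _         _ _  = λ _ → c≢0 refl
  take-normalized zero    (a ∷ X) c≢0 []        x eq = subst (_≢ 0ℤ) (proj₁ (∷-injective eq)) c≢0
  take-normalized zero    (a ∷ X) c≢0 (y ∷ ys)  x eq with ++-conicalʳ ys [ x ] (sym (proj₂ (∷-injective eq)))
  ... | ()
  take-normalized (suc N) (a ∷ X) c≢0 []       x eq = λ _ → c≢0 (empty-tail N X (proj₂ (∷-injective eq)))
    where
    empty-tail : ∀ N X → take (suc N) X ≡ [] → coeff X N ≡ 0ℤ
    empty-tail N [] _ = refl
  take-normalized (suc N) (a ∷ X) c≢0 (y ∷ ys) x eq = take-normalized N X c≢0 ys x (proj₂ (∷-injective eq))

  SignChangeAt : ℕ → Poly → Set
  SignChangeAt m p = (∀ k → 2 ℕ.+ k ≤ m → coeff p k ℤ.≤ coeff p (2 ℕ.+ k))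
                   × (∀ k → m ≤ 2 ℕ.+ k → coeff p (2 ℕ.+ k) ℤ.≤ coeff p k)

  half : ∀ m → Σ ℕ (λ j → j ℕ.+ j ≤ m × m ≤ suc (j ℕ.+ j))
  half zero          = 0 , z≤n , z≤n
  half (suc zero)    = 0 , z≤n , s≤s z≤n
  half (suc (suc m)) with half m
  ... | j , lo , hi = suc j , s≤s (subst (_≤ suc m) (sym (ℕP.+-suc j j)) (s≤s lo))
                            , s≤s (subst (suc m ≤_) (sym (cong suc (ℕP.+-suc j j))) (s≤s hi))

  mutual
    coeff-evens : ∀ l i → coeff (evens l) i ≡ coeff l (i ℕ.+ i)
    coeff-evens []      i       = refl
    coeff-evens (x ∷ l) zero    = refl
    coeff-evens (x ∷ l) (suc i) = trans (coeff-odds l i) (cong (coeff l) (sym (ℕP.+-suc i i)))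

    coeff-odds : ∀ l i → coeff (odds l) i ≡ coeff l (suc (i ℕ.+ i))
    coeff-odds []      i = refl
    coeff-odds (x ∷ l) i = coeff-evens l i

  -- The even-indexed coefficients peak at ⌊m/2⌋.
  sign-change-evens : ∀ m p → SignChangeAt m p → Unimodal (evens p)
  sign-change-evens m p (up , down) with half m
  ... | j , 2j≤m , m≤2j+1 = j , rising , falling
    where
    double-suc : ∀ i → suc i ℕ.+ suc i ≡ 2 ℕ.+ (i ℕ.+ i)
    double-suc i = cong suc (ℕP.+-suc i i)
    step : ∀ i → coeff (evens p) (suc i) ≡ coeff p (2 ℕ.+ (i ℕ.+ i))
    step i = trans (coeff-evens p (suc i)) (cong (coeff p) (double-suc i))
    rising : ∀ i → suc i ≤ j → suc i < length (evens p) → coeff (evens p) i ℤ.≤ coeff (evens p) (suc i)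
    rising i i<j _ = subst₂ ℤ._≤_ (sym (coeff-evens p i)) (sym (step i))
      (up (i ℕ.+ i) (ℕP.≤-trans (ℕP.≤-reflexive (sym (double-suc i))) (ℕP.≤-trans (ℕP.+-mono-≤ i<j i<j) 2j≤m)))
    falling : ∀ i → j ≤ i → suc i < length (evens p) → coeff (evens p) (suc i) ℤ.≤ coeff (evens p) i
    falling i j≤i _ = subst₂ ℤ._≤_ (sym (step i)) (sym (coeff-evens p i))
      (down (i ℕ.+ i) (ℕP.≤-trans m≤2j+1 (ℕP.m≤n⇒m≤1+n (s≤s (ℕP.+-mono-≤ j≤i j≤i)))))

  -- Dropping the constant term moves the sign change one step down; odds (x ∷ p) = evens p.
  sign-change-tail : ∀ m x p → SignChangeAt m (x ∷ p) → SignChangeAt (m ∸ 1) p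
  sign-change-tail zero    x p (up , down) = (λ k ()) , λ k _ → down (suc k) z≤n
  sign-change-tail (suc m) x p (up , down) = (λ k k+2≤m → up (suc k) (s≤s k+2≤m))
                                           , (λ k m≤k+2 → down (suc k) (s≤s m≤k+2))

  sign-change-unimodal : ∀ m p → SignChangeAt m p → UnimodalWrtParity p
  sign-change-unimodal m []      s = sign-change-evens m [] s , sign-change-evens m [] s
  sign-change-unimodal m (x ∷ p) s =
    sign-change-evens m (x ∷ p) s , sign-change-evens (m ∸ 1) p (sign-change-tail m x p s)

module CatalanIdentity where

  open PolynomialAlgebra
  open CoefficientSeries using (qprod)
  open import Data.Nat using (ℕ; suc)
  open import Data.List using (List; []; _∷_)
  open import Data.Fin using (zero; suc)
  open import Data.Vec using ([]; _∷_)
  open import Relation.Binary.PropositionalEquality using (trans)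
  open import Algebra.Solver.CommutativeMonoid polyMonoid using (Expr; prove; var; _⊕_; id)
  open import Relation.Binary.Reasoning.Setoid ≈ₚ-setoid

  steps : ℕ → List ℕ
  steps n = suc n ∷ suc (suc n) ∷ suc (suc (suc n)) ∷ []

  -- Since [4]! = [2][3][4] and [n+4]! = [n+4][n+3][n+2][n+1][n]!, the defining relation of
  -- [d] C_{4,n} is equivalent to [2][3][4] X = [d][n+1][n+2][n+3].
  catalan-from-product : ∀ d n X →
    qprod (2 ∷ 3 ∷ 4 ∷ []) X ≈ₚ qprod (d ∷ steps n) one →
    IsScaledQCatalan d 4 n X
  catalan-from-product d n X product = begin
    X *ₚ ([n+4] *ₚ (qfact 4 *ₚ qfact n))
      ≈⟨ prove 6 (x ⊕ (a ⊕ ((q₄ ⊕ (q₃ ⊕ (q₂ ⊕ (id ⊕ id)))) ⊕ f))) ((q₂ ⊕ (q₃ ⊕ (q₄ ⊕ x))) ⊕ (a ⊕ f))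
                 (X ∷ [n+4] ∷ qint 4 ∷ qint 3 ∷ qint 2 ∷ qfact n ∷ []) ⟩
    left *ₚ ([n+4] *ₚ qfact n)    ≈⟨ *ₚ-congˡ left right ([n+4] *ₚ qfact n) product ⟩
    right *ₚ ([n+4] *ₚ qfact n)
      ≈⟨ prove 6 ((x ⊕ (q₄ ⊕ (q₃ ⊕ (q₂ ⊕ id)))) ⊕ (a ⊕ f)) (x ⊕ (a ⊕ (q₂ ⊕ (q₃ ⊕ (q₄ ⊕ f)))))
                 (qint d ∷ [n+4] ∷ qint (suc n) ∷ qint (suc (suc n)) ∷ qint (suc (suc (suc n))) ∷ qfact n ∷ []) ⟩
    qint d *ₚ qfact (4 Data.Nat.+ n) ∎
    where
    left right [n+4] : Poly
    left  = qprod (2 ∷ 3 ∷ 4 ∷ []) X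
    right = qprod (d ∷ steps n) one
    [n+4] = qint (4 Data.Nat.+ n)
    x a q₄ q₃ q₂ f : Expr 6
    x = var zero
    a = var (suc zero)
    q₄ = var (suc (suc zero))
    q₃ = var (suc (suc (suc zero)))
    q₂ = var (suc (suc (suc (suc zero))))
    f = var (suc (suc (suc (suc (suc zero)))))

  scaled-catalan-resp : ∀ d m n P X → P ≈ₚ X → IsScaledQCatalan d m n X → IsScaledQCatalan d m n P
  scaled-catalan-resp d m n P X P≈X catalan i =
    trans (*ₚ-congˡ P X (qint (m Data.Nat.+ n) *ₚ (qfact m *ₚ qfact n)) P≈X i) (catalan i)

module CoreArgument where

  open PolynomialAlgebra
  open Series
  open CoefficientSeries
  open TruncationAndUnimodality
  open CatalanIdentity
  open import Data.Nat as ℕ using (ℕ; suc; _≤_; _<_; z≤n; s≤s)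
  import Data.Nat.Properties as ℕP
  open import Data.Nat.ListAction using (sum)
  open import Data.Nat.Solver using (module +-*-Solver)
  open +-*-Solver using (solve; _:+_; con; _:=_)
  open import Data.Empty using (⊥)
  open import Data.Integer as ℤ using (ℤ; +_; 0ℤ; 1ℤ; _+_; _-_; -_)
  open import Data.Integer.Properties using (+-identityʳ; 0≤i-j⇒j≤i; i-j≤0⇒i≤j; i≤j⇒0≤j-i)
  open import Data.List using (List; []; _∷_; take; length)
  open import Data.List.Relation.Unary.All using (All; []; _∷_)
  open import Data.Product using (Σ; _×_; _,_; proj₁; proj₂)
  open import Relation.Binary.PropositionalEquality hiding ([_])
  open import Relation.Nullary using (yes; no)

  -- The power series F = [d] / ((1 - q³)(1 - q⁴)) (with d = d' + 1), which has
  -- nonnegative coefficients dominating its own three-term window sums far enough out.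
  record Dominating (d′ : ℕ) : Set where
    field
      F           : ℕ → ℤ
      nonnegative : ∀ x → 0ℤ ℤ.≤ F x
      dominates   : ∀ j x → j ℕ.+ j ℕ.+ j ℕ.+ 6 ≤ x ℕ.+ d′ → window 3 (ext F) (+ j) ℤ.≤ F x
      generates   : Δ* (3 ∷ 4 ∷ []) (ext F) ≐ seq (qint (suc d′))

  steps-positive : ∀ n → All Positive (steps n)
  steps-positive n = s≤s z≤n ∷ s≤s z≤n ∷ s≤s z≤n ∷ []

  small-positive : All Positive (2 ∷ 3 ∷ 4 ∷ [])
  small-positive = s≤s z≤n ∷ s≤s z≤n ∷ s≤s z≤n ∷ []

  -- The degree relation deg X + deg([2][3][4]) = deg([d][n+1][n+2][n+3]), in terms of c.
  degree-balance : ∀ n d′ c → c ℕ.+ c ℕ.+ 3 ≡ n ℕ.+ n ℕ.+ n ℕ.+ d′ →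
    c ℕ.+ c ℕ.+ 9 ≡ d′ ℕ.+ sum (steps n)
  degree-balance n d′ c balance = begin
    c ℕ.+ c ℕ.+ 9                    ≡⟨ solve 1 (λ c → c :+ c :+ con 9 := (c :+ c :+ con 3) :+ con 6) refl c ⟩
    (c ℕ.+ c ℕ.+ 3) ℕ.+ 6            ≡⟨ cong (ℕ._+ 6) balance ⟩
    (n ℕ.+ n ℕ.+ n ℕ.+ d′) ℕ.+ 6
      ≡⟨ solve 2 (λ n d′ → n :+ n :+ n :+ d′ :+ con 6
                            := d′ :+ (con 1 :+ n :+ (con 2 :+ n :+ (con 3 :+ n :+ con 0)))) refl n d′ ⟩
    d′ ℕ.+ (suc n ℕ.+ (suc (suc n) ℕ.+ (suc (suc (suc n)) ℕ.+ 0))) ∎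
    where open ≡-Reasoning

  below-pair-sums : ∀ n d′ c k → d′ ≤ 3 → c ℕ.+ c ℕ.+ 3 ≡ n ℕ.+ n ℕ.+ n ℕ.+ d′ → k ≤ c →
    k < suc n ℕ.+ suc (suc n)
  below-pair-sums n d′ c k d′≤3 balance k≤c = ℕP.≰⇒> too-big
    where
    k+k≤3n : k ℕ.+ k ≤ n ℕ.+ n ℕ.+ n
    k+k≤3n = ℕP.+-cancelʳ-≤ 3 _ _ (ℕP.≤-trans (ℕP.+-monoˡ-≤ 3 (ℕP.+-mono-≤ k≤c k≤c))
                                   (ℕP.≤-trans (ℕP.≤-reflexive balance) (ℕP.+-monoʳ-≤ (n ℕ.+ n ℕ.+ n) d′≤3)))
    gap : n ℕ.+ n ℕ.+ n ℕ.+ suc (n ℕ.+ 5) ≡ suc n ℕ.+ suc (suc n) ℕ.+ (suc n ℕ.+ suc (suc n))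
    gap = solve 1 (λ n → n :+ n :+ n :+ (con 1 :+ (n :+ con 5))
                         := con 1 :+ n :+ (con 2 :+ n) :+ (con 1 :+ n :+ (con 2 :+ n))) refl n
    too-big : suc n ℕ.+ suc (suc n) ≤ k → ⊥
    too-big 2n+3≤k = ℕP.<-irrefl refl (ℕP.<-≤-trans (ℕP.m<m+n (n ℕ.+ n ℕ.+ n) (s≤s z≤n))
      (ℕP.≤-trans (ℕP.≤-reflexive gap) (ℕP.≤-trans (ℕP.+-mono-≤ 2n+3≤k 2n+3≤k) k+k≤3n)))

  within-dominance : ∀ n d′ c j → c ℕ.+ c ℕ.+ 3 ≡ n ℕ.+ n ℕ.+ n ℕ.+ d′ → suc n ℕ.+ j ≤ c →
    j ℕ.+ j ℕ.+ j ℕ.+ 6 ≤ suc n ℕ.+ j ℕ.+ d′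
  within-dominance n d′ c j balance k≤c = begin
    j ℕ.+ j ℕ.+ j ℕ.+ 6
      ≡⟨ solve 1 (λ j → j :+ j :+ j :+ con 6 := j :+ j :+ con 5 :+ (con 1 :+ j)) refl j ⟩
    j ℕ.+ j ℕ.+ 5 ℕ.+ suc j
      ≤⟨ ℕP.+-monoˡ-≤ (suc j) 2j+5≤n+d′ ⟩
    n ℕ.+ d′ ℕ.+ suc j
      ≡⟨ solve 3 (λ n d′ j → n :+ d′ :+ (con 1 :+ j) := con 1 :+ n :+ j :+ d′) refl n d′ j ⟩
    suc n ℕ.+ j ℕ.+ d′ ∎
    where
    open ℕP.≤-Reasoning
    doubled : n ℕ.+ n ℕ.+ (j ℕ.+ j ℕ.+ 5) ≤ n ℕ.+ n ℕ.+ (n ℕ.+ d′)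
    doubled = subst₂ _≤_
      (solve 2 (λ n j → con 1 :+ n :+ j :+ (con 1 :+ n :+ j) :+ con 3 := n :+ n :+ (j :+ j :+ con 5)) refl n j)
      (solve 2 (λ n d′ → n :+ n :+ n :+ d′ := n :+ n :+ (n :+ d′)) refl n d′)
      (ℕP.≤-trans (ℕP.+-monoˡ-≤ 3 (ℕP.+-mono-≤ k≤c k≤c)) (ℕP.≤-reflexive balance))
    2j+5≤n+d′ : j ℕ.+ j ℕ.+ 5 ≤ n ℕ.+ d′
    2j+5≤n+d′ = ℕP.+-cancelˡ-≤ (n ℕ.+ n) _ _ doubled

  module ParityUnimodality (n d′ c : ℕ) (X : Poly)
    (product : qprod (2 ∷ 3 ∷ 4 ∷ []) X ≈ₚ qprod (suc d′ ∷ steps n) one)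
    (balance : c ℕ.+ c ℕ.+ 3 ≡ n ℕ.+ n ℕ.+ n ℕ.+ d′)
    (d′≤3 : d′ ≤ 3)
    (dominating : Dominating d′) where

    open Dominating dominating

    N : ℕ
    N = c ℕ.+ c

    x̂ ŵ : Seq
    x̂ = seq X
    ŵ = seq (qint (suc d′))

    -- Both sides of the difference identity are symmetric about the same point.
    centres : N ℕ.+ 9 ≡ d′ ℕ.+ sum (steps n)
    centres = degree-balance n d′ c balance

    -- Multiplying the product identity by (1 - q)³:
    -- (1 - q²)(1 - q³)(1 - q⁴) X = [d] (1 - q^(n+1))(1 - q^(n+2))(1 - q^(n+3)).
    difference-identity : Δ* (2 ∷ 3 ∷ 4 ∷ []) x̂ ≐ Δ* (steps n) ŵ
    difference-identity =
      ≐-trans (≐-sym (Δ1s-window* (2 ∷ 3 ∷ 4 ∷ []) x̂)) (≐-trans (Δ*-cong ones windows) right)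
      where
      ones : List ℕ
      ones = 1 ∷ 1 ∷ 1 ∷ []
      δ : Seq
      δ = seq one
      windows : window* (2 ∷ 3 ∷ 4 ∷ []) x̂ ≐ window* (suc d′ ∷ steps n) δ
      windows = ≐-trans (≐-sym (seq-qprod (2 ∷ 3 ∷ 4 ∷ []) X))
                        (≐-trans (seq-≈ (qprod (2 ∷ 3 ∷ 4 ∷ []) X) (qprod (suc d′ ∷ steps n) one) product)
                                 (seq-qprod (suc d′ ∷ steps n) one))
      [d]-seq : window (suc d′) δ ≐ ŵ
      [d]-seq = ≐-trans (≐-sym (seq-qint* (suc d′) one))
                        (seq-≈ (qint (suc d′) *ₚ one) (qint (suc d′)) (*ₚ-identityʳ (qint (suc d′))))
      right : Δ* ones (window* (suc d′ ∷ steps n) δ) ≐ Δ* (steps n) ŵ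
      right = ≐-trans (≐-sym (window-Δ*-comm (suc d′) ones (window* (steps n) δ)))
              (≐-trans (window-cong (suc d′) (Δ1s-window* (steps n) δ))
              (≐-trans (window-Δ*-comm (suc d′) (steps n) δ)
                       (Δ*-cong (steps n) [d]-seq)))

    -- deg X ≤ 2c, since the right side has degree ≤ 2c + 9.
    degree-bound : VanishesFrom (suc N) x̂
    degree-bound = Δ*-vanishes-down (2 ∷ 3 ∷ 4 ∷ []) (length X) (suc N) x̂ small-positive (seq-vanishes X)
      λ m N+10≤m → trans (difference-identity (+ m))
        (Δ*-vanishes (steps n) (suc d′) ŵ (qint-vanishes (suc d′)) m (subst (_≤ m) (cong suc centres) N+10≤m))

    -- X is palindromic about 2c, because [d] is palindromic about d - 1.
    palindromic : Palindromic N x̂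
    palindromic = palindromic-transfer (2 ∷ 3 ∷ 4 ∷ []) (steps n) N d′ x̂ ŵ small-positive refl centres
      (ext-causal (coeff X)) degree-bound (qint-palindromic d′) difference-identity

    -- The coefficient of q^2c equals the constant term, which is 1: deg X = 2c exactly.
    leading-coefficient : coeff X N ≡ 1ℤ
    leading-coefficient = begin
      x̂ (+ N)                      ≡⟨ cong x̂ (+-identityʳ (+ N)) ⟨
      x̂ (+ N - + 0)                ≡⟨ palindromic (+ 0) ⟩
      x̂ (+ 0)                      ≡⟨ Δ*-constant-term (2 ∷ 3 ∷ 4 ∷ []) x̂ small-positive (ext-causal (coeff X)) ⟨
      Δ* (2 ∷ 3 ∷ 4 ∷ []) x̂ (+ 0)  ≡⟨ difference-identity (+ 0) ⟩
      Δ* (steps n) ŵ (+ 0)         ≡⟨ Δ*-constant-term (steps n) ŵ (steps-positive n) (ext-causal (coeff (qint (suc d′)))) ⟩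
      1ℤ                           ∎
      where open ≡-Reasoning

    -- D = (1 - q²) X has the step-two differences a(k) - a(k - 2) as coefficients.
    D : Seq
    D = Δ 2 x̂

    D-causal : Causal D
    D-causal = Δ-causal 2 x̂ (ext-causal (coeff X))

    D-antisymmetric : reflect (+ (suc c ℕ.+ suc c)) D ≐ λ x → - D x
    D-antisymmetric x = trans (cong (λ M → D (M - x)) centre)
                              (trans (Δ-reflect 2 (+ N) x̂ x) (cong -_ (Δ-cong 2 palindromic x)))
      where
      centre : + (suc c ℕ.+ suc c) ≡ + N + + 2
      centre = cong +_ (solve 1 (λ c → con 1 :+ c :+ (con 1 :+ c) := c :+ c :+ con 2) refl c)

    -- Cancelling (1 - q³)(1 - q⁴): D = (1 - q^(n+1))(1 - q^(n+2))(1 - q^(n+3)) F.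
    D-from-F : D ≐ Δ* (steps n) (ext F)
    D-from-F = Δ*-cancel (3 ∷ 4 ∷ []) (s≤s z≤n ∷ s≤s z≤n ∷ []) D-causal
                 (Δ*-causal (steps n) (ext F) (ext-causal F)) same-image
      where
      same-image : Δ* (3 ∷ 4 ∷ []) D ≐ Δ* (3 ∷ 4 ∷ []) (Δ* (steps n) (ext F))
      same-image = ≐-trans (≐-sym (Δ-Δ*-comm 2 (3 ∷ 4 ∷ []) x̂))
                   (≐-trans difference-identity
                   (≐-trans (Δ*-cong (steps n) (≐-sym generates))
                            (Δ*-comm (steps n) (3 ∷ 4 ∷ []) (ext F))))

    -- Up to degree c, D is F minus a window sum of F that F dominates.
    D-nonnegative : ∀ k → k ≤ c → 0ℤ ℤ.≤ D (+ k)
    D-nonnegative k k≤c =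
      subst (0ℤ ℤ.≤_) (sym (trans (D-from-F (+ k))
                                 (Δ-consecutive-low-degree n (ext F) (ext-causal F) k
                                   (below-pair-sums n d′ c k d′≤3 balance k≤c))))
            (i≤j⇒0≤j-i window≤F)
      where
      W : Seq
      W = window 3 (ext F)
      window≤F : W (+ k - + suc n) ℤ.≤ F k
      window≤F with k ℕP.≤? n
      ... | yes k≤n = subst (ℤ._≤ F k) (sym (causal-< W (window-causal 3 (ext F) (ext-causal F)) k (suc n) (s≤s k≤n)))
                            (nonnegative k)
      ... | no  k≰n = subst (λ y → W y ℤ.≤ F k) (sym (sub-≥ k (suc n) n<k))
                        (dominates j k (subst (λ i → j ℕ.+ j ℕ.+ j ℕ.+ 6 ≤ i ℕ.+ d′) k≡n+1+j
                          (within-dominance n d′ c j balance (subst (_≤ c) (sym k≡n+1+j) k≤c))))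
        where
        n<k : n < k
        n<k = ℕP.≰⇒> k≰n
        j : ℕ
        j = k ℕ.∸ suc n
        k≡n+1+j : suc n ℕ.+ j ≡ k
        k≡n+1+j = ℕP.m+[n∸m]≡n n<k

    P : Poly
    P = take (suc N) X

    P≈X : P ≈ₚ X
    P≈X = take-≈ N X degree-bound

    -- Antisymmetry turns nonnegativity below c + 1 into one sign change of D at c + 1.
    sign-change : SignChangeAt (suc c) P
    sign-change =
        (λ k 2+k≤c+1 → subst₂ ℤ._≤_ (sym (P≈X k)) (sym (P≈X (2 ℕ.+ k)))
                         (0≤i-j⇒j≤i (proj₁ signs (2 ℕ.+ k) 2+k≤c+1)))
      , (λ k c+1≤2+k → subst₂ ℤ._≤_ (sym (P≈X (2 ℕ.+ k))) (sym (P≈X k))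
                         (i-j≤0⇒i≤j (proj₂ signs (2 ℕ.+ k) c+1≤2+k)))
      where
      signs : (∀ k → k ≤ suc c → 0ℤ ℤ.≤ D (+ k)) × (∀ k → suc c ≤ k → D (+ k) ℤ.≤ 0ℤ)
      signs = antisymmetric-sign (suc c) D D-causal D-antisymmetric (λ k k<c+1 → D-nonnegative k (ℕP.≤-pred k<c+1))

    result : Σ Poly (λ P → Normalized P × IsScaledQCatalan (suc d′) 4 n P × UnimodalWrtParity P)
    result = P
           , take-normalized N X (λ c≡0 → 1≢0 (trans (sym leading-coefficient) c≡0))
           , scaled-catalan-resp (suc d′) 4 n P X P≈X (catalan-from-product (suc d′) n X product)
           , sign-change-unimodal (suc c) P sign-change
      where
      1≢0 : 1ℤ ≢ 0ℤ
      1≢0 ()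

module DominatingSeries where

  open Series
  open CoefficientSeries using (seq; qint-vanishes)
  open CoreArgument using (Dominating)
  open import Data.Nat as ℕ using (ℕ; zero; suc; _≤_; _<_; z≤n; s≤s; NonZero)
  import Data.Nat.Properties as ℕP
  open import Data.Nat.DivMod using (_%_; _/_; m≡m%n+[m/n]*n; m%n<n; [m+n]%n≡m%n; m/n≡1+[m∸n]/n)
  import Data.Nat.Solver
  open import Data.Integer as ℤ using (ℤ; +_; -[1+_]; 0ℤ; _+_; _-_)
  open import Data.Integer.Properties using (pos-+; +-monoʳ-≤; +-mono-≤; ≤-trans) renaming (≤-reflexive to ℤ-≤-reflexive)
  import Data.Integer.Solver
  open import Data.Fin using (Fin; toℕ; fromℕ<)
  open import Data.Fin.Properties using (all?; toℕ-fromℕ<)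
  open import Data.List using (List; []; _∷_)
  open import Data.Unit using (tt)
  open import Relation.Binary.PropositionalEquality hiding ([_])
  open import Relation.Nullary using (Dec; yes; no)
  open import Relation.Nullary.Decidable using (True; toWitness)

  module ℕS = Data.Nat.Solver.+-*-Solver
  module ℤS = Data.Integer.Solver.+-*-Solver

  periodic-induction : ∀ p .{{_ : NonZero p}} {P : ℕ → Set} →
    (∀ x → x < p → P x) → (∀ x → P x → P (p ℕ.+ x)) → ∀ x → P x
  periodic-induction p {P} base step x = subst P (sym (m≡m%n+[m/n]*n x p)) (go (x / p))
    where
    go : ∀ k → P (x % p ℕ.+ k ℕ.* p)
    go zero    = subst P (sym (ℕP.+-identityʳ (x % p))) (base (x % p) (m%n<n x p))
    go (suc k) = subst P (ℕS.solve 3 (λ r p k → p ℕS.:+ (r ℕS.:+ k ℕS.:* p) ℕS.:= r ℕS.:+ (p ℕS.:+ k ℕS.:* p)) refl (x % p) p k)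
                         (step _ (go k))

  Checked : ∀ p {P : ℕ → Set} → (∀ x → Dec (P x)) → Set
  Checked p P? = True (all? (λ (i : Fin p) → P? (toℕ i)))

  checked-below : ∀ p {P : ℕ → Set} (P? : ∀ x → Dec (P x)) → Checked p P? → ∀ x → x < p → P x
  checked-below p {P} P? ok x x<p = subst P (toℕ-fromℕ< x<p) (toWitness ok (fromℕ< x<p))

  quasi : (p : ℕ) .{{_ : NonZero p}} → (ℕ → ℤ) → ℕ → ℕ → ℤ
  quasi p t s x = t (x % p) + + (x / p ℕ.* s)

  quasi-step : ∀ p .{{_ : NonZero p}} t s x → quasi p t s (p ℕ.+ x) ≡ + s + quasi p t s x
  quasi-step p t s x = begin
    t ((p ℕ.+ x) % p) + + ((p ℕ.+ x) / p ℕ.* s)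
      ≡⟨ cong₂ (λ r q → t r + + (q ℕ.* s)) residue quotient ⟩
    t (x % p) + + (s ℕ.+ x / p ℕ.* s)
      ≡⟨ cong (λ z → t (x % p) + z) (pos-+ s (x / p ℕ.* s)) ⟩
    t (x % p) + (+ s + + (x / p ℕ.* s))
      ≡⟨ ℤS.solve 3 (λ a b c → a ℤS.:+ (b ℤS.:+ c) ℤS.:= b ℤS.:+ (a ℤS.:+ c)) refl (t (x % p)) (+ s) (+ (x / p ℕ.* s)) ⟩
    + s + quasi p t s x ∎
    where
    open ≡-Reasoning
    residue : (p ℕ.+ x) % p ≡ x % p
    residue = trans (cong (_% p) (ℕP.+-comm p x)) ([m+n]%n≡m%n x p)
    quotient : (p ℕ.+ x) / p ≡ suc (x / p)
    quotient = trans (m/n≡1+[m∸n]/n (ℕP.m≤m+n p x)) (cong (λ y → suc (y / p)) (ℕP.m+n∸m≡n p x))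

  -- F is given by a table over one period growing by s per period, and L by a
  -- second such table; L is a nondecreasing minorant of F that bounds the window
  -- sums of F from above.  All properties reduce to finitely many checks.
  module FromTables (d′ : ℕ) (f l : List ℤ) (s c₀ : ℕ) (c₀+d′≡6 : c₀ ℕ.+ d′ ≡ 6) where

    F L : ℕ → ℤ
    F = quasi 12 (coeff f) s
    L = quasi 12 (coeff l) s

    -- The window sum F(j) + F(j - 1) + F(j - 2), and the point 3j + c₀ beyond which F exceeds it.
    W : ℕ → ℤ
    W j = window 3 (ext F) (+ j)

    bound : ℕ → ℕ
    bound j = j ℕ.+ j ℕ.+ j ℕ.+ c₀

    nonnegative? : ∀ x → Dec (0ℤ ℤ.≤ F x)
    nonnegative? x = 0ℤ ℤ.≤? F x

    below? : ∀ x → Dec (L x ℤ.≤ F x)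
    below? x = L x ℤ.≤? F x

    rising? : ∀ x → Dec (L x ℤ.≤ L (suc x))
    rising? x = L x ℤ.≤? L (suc x)

    window? : ∀ j → Dec (W j ℤ.≤ L (bound j))
    window? j = W j ℤ.≤? L (bound j)

    -- (1 - q³)(1 - q⁴) F at degree m + 7
    recurrence? : ∀ m → Dec ((F (7 ℕ.+ m) - F (3 ℕ.+ m)) - (F (4 ℕ.+ m) - F m) ≡ 0ℤ)
    recurrence? m = (F (7 ℕ.+ m) - F (3 ℕ.+ m)) - (F (4 ℕ.+ m) - F m) ℤ.≟ 0ℤ

    initial? : ∀ m → Dec (Δ* (3 ∷ 4 ∷ []) (ext F) (+ m) ≡ coeff (qint (suc d′)) m)
    initial? m = Δ* (3 ∷ 4 ∷ []) (ext F) (+ m) ℤ.≟ coeff (qint (suc d′)) m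

    shift-≤ : ∀ (g h : ℕ → ℤ) → (∀ z → g (12 ℕ.+ z) ≡ + s + g z) → (∀ z → h (12 ℕ.+ z) ≡ + s + h z) →
              ∀ x y → g x ℤ.≤ h y → g (12 ℕ.+ x) ℤ.≤ h (12 ℕ.+ y)
    shift-≤ g h g-step h-step x y g≤h = subst₂ ℤ._≤_ (sym (g-step x)) (sym (h-step y)) (+-monoʳ-≤ (+ s) g≤h)

    F-step : ∀ z → F (12 ℕ.+ z) ≡ + s + F z
    F-step = quasi-step 12 (coeff f) s

    L-step : ∀ z → L (12 ℕ.+ z) ≡ + s + L z
    L-step = quasi-step 12 (coeff l) s

    module Verified (nonnegative-ok : Checked 12 nonnegative?) (below-ok : Checked 12 below?)
                    (rising-ok : Checked 12 rising?) (window-ok : Checked 14 window?)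
                    (recurrence-ok : Checked 12 recurrence?) (initial-ok : Checked 7 initial?) where

      -- Each property below holds on one period by evaluation and is preserved
      -- when all arguments move by a period.

      nonnegative : ∀ x → 0ℤ ℤ.≤ F x
      nonnegative = periodic-induction 12 (checked-below 12 nonnegative? nonnegative-ok)
        λ x 0≤Fx → subst (0ℤ ℤ.≤_) (sym (F-step x)) (+-mono-≤ (ℤ.+≤+ z≤n) 0≤Fx)

      L≤F : ∀ x → L x ℤ.≤ F x
      L≤F = periodic-induction 12 (checked-below 12 below? below-ok) λ x → shift-≤ L F L-step F-step x x

      L-monotone : ∀ x k → L x ℤ.≤ L (k ℕ.+ x)
      L-monotone x zero    = ℤ-≤-reflexive refl
      L-monotone x (suc k) = ≤-trans (L-monotone x k) (L-rising (k ℕ.+ x))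
        where
        L-rising : ∀ y → L y ℤ.≤ L (suc y)
        L-rising = periodic-induction 12 (checked-below 12 rising? rising-ok) (λ y → shift-≤ L L L-step L-step y (suc y))

      -- From j = 2 on, the window sum grows by 3s when j grows by 12, as does L(3j + c₀).
      W≤L : ∀ j → W j ℤ.≤ L (bound j)
      W≤L zero          = checked-below 14 window? window-ok 0 (s≤s z≤n)
      W≤L (suc zero)    = checked-below 14 window? window-ok 1 (s≤s (s≤s z≤n))
      W≤L (suc (suc m)) =
        periodic-induction 12 (λ m m<12 → checked-below 14 window? window-ok (2 ℕ.+ m) (s≤s (s≤s m<12))) step m
        where
        three-periods : ∀ j → bound (12 ℕ.+ j) ≡ 12 ℕ.+ (12 ℕ.+ (12 ℕ.+ bound j))
        three-periods j = ℕS.solve 2 (λ j c → (ℕS.con 12 ℕS.:+ j) ℕS.:+ (ℕS.con 12 ℕS.:+ j) ℕS.:+ (ℕS.con 12 ℕS.:+ j) ℕS.:+ c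
                                          ℕS.:= ℕS.con 36 ℕS.:+ (j ℕS.:+ j ℕS.:+ j ℕS.:+ c)) refl j c₀
        step : ∀ m → W (2 ℕ.+ m) ℤ.≤ L (bound (2 ℕ.+ m)) → W (2 ℕ.+ (12 ℕ.+ m)) ℤ.≤ L (bound (2 ℕ.+ (12 ℕ.+ m)))
        step m W≤ = subst₂ ℤ._≤_ (sym W-shift) (sym (trans (cong L (three-periods (2 ℕ.+ m))) L-shift))
                           (+-monoʳ-≤ (+ s) (+-monoʳ-≤ (+ s) (+-monoʳ-≤ (+ s) W≤)))
          where
          y : ℕ
          y = bound (2 ℕ.+ m)
          W-shift : W (14 ℕ.+ m) ≡ + s + (+ s + (+ s + W (2 ℕ.+ m)))
          W-shift =
            trans (cong₂ _+_ (F-step (2 ℕ.+ m)) (cong₂ (λ a b → a + (b + 0ℤ)) (F-step (1 ℕ.+ m)) (F-step m)))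
                  (ℤS.solve 4 (λ s a b c → (s ℤS.:+ a) ℤS.:+ ((s ℤS.:+ b) ℤS.:+ ((s ℤS.:+ c) ℤS.:+ ℤS.con 0ℤ))
                                        ℤS.:= s ℤS.:+ (s ℤS.:+ (s ℤS.:+ (a ℤS.:+ (b ℤS.:+ (c ℤS.:+ ℤS.con 0ℤ))))))
                          refl (+ s) (F (2 ℕ.+ m)) (F (1 ℕ.+ m)) (F m))
          L-shift : L (12 ℕ.+ (12 ℕ.+ (12 ℕ.+ y))) ≡ + s + (+ s + (+ s + L y))
          L-shift = trans (L-step (12 ℕ.+ (12 ℕ.+ y)))
                          (cong (λ z → + s + z) (trans (L-step (12 ℕ.+ y)) (cong (λ z → + s + z) (L-step y))))

      -- W j ≤ L(3j + c₀) ≤ L x ≤ F x as soon as x ≥ 3j + c₀ = 3j + 6 - d′.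
      dominates : ∀ j x → j ℕ.+ j ℕ.+ j ℕ.+ 6 ≤ x ℕ.+ d′ → W j ℤ.≤ F x
      dominates j x 3j+6≤x+d′ =
        ≤-trans (W≤L j) (≤-trans (subst (λ z → L (bound j) ℤ.≤ L z) (ℕP.m∸n+n≡m j-bound≤x)
                                        (L-monotone (bound j) (x ℕ.∸ bound j)))
                                 (L≤F x))
        where
        j-bound≤x : bound j ≤ x
        j-bound≤x = ℕP.+-cancelʳ-≤ d′ (bound j) x (subst (_≤ x ℕ.+ d′)
          (trans (cong (j ℕ.+ j ℕ.+ j ℕ.+_) (sym c₀+d′≡6)) (sym (ℕP.+-assoc (j ℕ.+ j ℕ.+ j) c₀ d′))) 3j+6≤x+d′)

      -- (1 - q³)(1 - q⁴) F vanishes from degree 7 on; the slope s cancels between periods.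
      recurrence : ∀ m → (F (7 ℕ.+ m) - F (3 ℕ.+ m)) - (F (4 ℕ.+ m) - F m) ≡ 0ℤ
      recurrence = periodic-induction 12 (checked-below 12 recurrence? recurrence-ok) λ m h →
        trans (cong₂ _-_ (cong₂ _-_ (F-step (7 ℕ.+ m)) (F-step (3 ℕ.+ m))) (cong₂ _-_ (F-step (4 ℕ.+ m)) (F-step m)))
              (trans (ℤS.solve 5 (λ s a b c e → ((s ℤS.:+ a) ℤS.:- (s ℤS.:+ b)) ℤS.:- ((s ℤS.:+ c) ℤS.:- (s ℤS.:+ e))
                                           ℤS.:= (a ℤS.:- b) ℤS.:- (c ℤS.:- e))
                                 refl (+ s) (F (7 ℕ.+ m)) (F (3 ℕ.+ m)) (F (4 ℕ.+ m)) (F m)) h)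

      -- (1 - q³)(1 - q⁴) F = [d]: checked below degree 7, and both sides vanish beyond.
      generates : Δ* (3 ∷ 4 ∷ []) (ext F) ≐ seq (qint (suc d′))
      generates -[1+ m ] = Δ*-causal (3 ∷ 4 ∷ []) (ext F) (ext-causal F) m
      generates (+ m) with m ℕP.<? 7
      ... | yes m<7 = checked-below 7 initial? initial-ok m m<7
      ... | no  m≮7 = subst (λ k → Δ* (3 ∷ 4 ∷ []) (ext F) (+ k) ≡ seq (qint (suc d′)) (+ k))
                            (ℕP.m+[n∸m]≡n (ℕP.≮⇒≥ m≮7))
                            (trans (recurrence (m ℕ.∸ 7)) (sym (qint-vanishes (suc d′) (7 ℕ.+ (m ℕ.∸ 7)) d≤m)))
        where
        d≤m : suc d′ ≤ 7 ℕ.+ (m ℕ.∸ 7)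
        d≤m = ℕP.≤-trans (s≤s (ℕP.≤-trans (ℕP.m≤n+m d′ c₀) (ℕP.≤-reflexive c₀+d′≡6))) (ℕP.m≤m+n 7 (m ℕ.∸ 7))

      dominating = record { F = F ; nonnegative = nonnegative ; dominates = dominates ; generates = generates }

  -- F = 1 / ((1 - q³)(1 - q⁴)) and its minorant L.
  dominating₁ : Dominating 0
  dominating₁ = FromTables.Verified.dominating 0
    (+ 1 ∷ + 0 ∷ + 0 ∷ + 1 ∷ + 1 ∷ + 0 ∷ + 1 ∷ + 1 ∷ + 1 ∷ + 1 ∷ + 1 ∷ + 1 ∷ [])
    (+ 0 ∷ + 0 ∷ + 0 ∷ + 0 ∷ + 0 ∷ + 0 ∷ + 1 ∷ + 1 ∷ + 1 ∷ + 1 ∷ + 1 ∷ + 1 ∷ [])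
    1 6 refl tt tt tt tt tt tt

  -- F = (1 + q) / ((1 - q³)(1 - q⁴)).
  dominating₂ : Dominating 1
  dominating₂ = FromTables.Verified.dominating 1
    (+ 1 ∷ + 1 ∷ + 0 ∷ + 1 ∷ + 2 ∷ + 1 ∷ + 1 ∷ + 2 ∷ + 2 ∷ + 2 ∷ + 2 ∷ + 2 ∷ [])
    (+ 0 ∷ + 0 ∷ + 0 ∷ + 0 ∷ + 0 ∷ + 1 ∷ + 1 ∷ + 1 ∷ + 2 ∷ + 2 ∷ + 2 ∷ + 2 ∷ [])
    2 5 refl tt tt tt tt tt tt

  -- F = [4] / ((1 - q³)(1 - q⁴)) = 1 / ((1 - q)(1 - q³)), which is nondecreasing: L = F.
  dominating₄ : Dominating 3
  dominating₄ = FromTables.Verified.dominating 3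
    (+ 1 ∷ + 1 ∷ + 1 ∷ + 2 ∷ + 2 ∷ + 2 ∷ + 3 ∷ + 3 ∷ + 3 ∷ + 4 ∷ + 4 ∷ + 4 ∷ [])
    (+ 1 ∷ + 1 ∷ + 1 ∷ + 2 ∷ + 2 ∷ + 2 ∷ + 3 ∷ + 3 ∷ + 3 ∷ + 4 ∷ + 4 ∷ + 4 ∷ [])
    4 3 refl tt tt tt tt tt tt

module CatalanQuotient where

  open PolynomialAlgebra
  open CoefficientSeries using (qprod)
  open CatalanIdentity using (steps)
  open import Data.Nat as ℕ using (ℕ; zero; suc; s≤s)
  open import Data.Nat.Divisibility using (_∣_; divides; _∣?_; ∣-trans; ∣-antisym; n∣m*n; ∣m∣n⇒∣m+n; ∣m+n∣m⇒∣n)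
  open import Data.Nat.DivMod using (_%_; _/_; m≡m%n+[m/n]*n; m%n<n)
  open import Data.Nat.GCD using (gcd; gcd[m,n]∣m; gcd[m,n]∣n; gcd-greatest)
  import Data.Nat.Properties as ℕP
  open import Data.Integer as ℤ using (+_; -[1+_]; 0ℤ)
  open import Data.List using (List; []; _∷_)
  open import Data.Product using (Σ; _,_)
  open import Data.Fin using (zero; suc)
  import Data.Vec
  open Data.Vec using ([]; _∷_)
  open import Relation.Binary.PropositionalEquality hiding ([_])
  open import Relation.Nullary.Decidable using (True; toWitness)
  open import Algebra.Solver.CommutativeMonoid polyMonoid using (Expr; prove; var; _⊕_; id)
  open import Relation.Binary.Reasoning.Setoid ≈ₚ-setoid

  -- P divides Q, with an explicit quotient.  (A record, so that P and Q are recovered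
  -- by unification from the type.)
  infix 4 _∣ₚ_
  record _∣ₚ_ (P Q : Poly) : Set where
    constructor _witnesses_
    field
      quotient : Poly
      exact    : P *ₚ quotient ≈ₚ Q

  ∣ₚ-refl : ∀ P → P ∣ₚ P
  ∣ₚ-refl P = one witnesses *ₚ-identityʳ P

  one-∣ₚ : ∀ P → one ∣ₚ P
  one-∣ₚ P = P witnesses *ₚ-identityˡ P

  ∣ₚ-trans : ∀ {P Q S} → P ∣ₚ Q → Q ∣ₚ S → P ∣ₚ S
  ∣ₚ-trans {P} {Q} {S} (R witnesses PR≈Q) (R′ witnesses QR′≈S) = (R *ₚ R′) witnesses (begin
    P *ₚ (R *ₚ R′)   ≈⟨ *ₚ-assoc P R R′ ⟨
    (P *ₚ R) *ₚ R′   ≈⟨ *ₚ-congˡ (P *ₚ R) Q R′ PR≈Q ⟩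
    Q *ₚ R′          ≈⟨ QR′≈S ⟩
    S                ∎)

  shift : ℕ → Poly → Poly
  shift zero    p = p
  shift (suc a) p = 0ℤ ∷ shift a p

  shift-cong : ∀ a p r → p ≈ₚ r → shift a p ≈ₚ shift a r
  shift-cong zero    p r e = e
  shift-cong (suc a) p r e = ∷-cong 0ℤ (shift-cong a p r e)

  shift-*ₚ : ∀ a x s → shift a x *ₚ s ≈ₚ shift a (x *ₚ s)
  shift-*ₚ zero    x s i = refl
  shift-*ₚ (suc a) x s i = trans (0∷-*ₚ (shift a x) s i) (∷-cong 0ℤ (shift-*ₚ a x s) i)

  qint-+ : ∀ a c → qint (a ℕ.+ c) ≈ₚ qint a +ₚ shift a (qint c)
  qint-+ zero    c i       = refl
  qint-+ (suc a) c zero    = refl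
  qint-+ (suc a) c (suc i) = qint-+ a c i

  geometric : ℕ → ℕ → Poly
  geometric b zero    = []
  geometric b (suc k) = one +ₚ shift b (geometric b k)

  geometric-qint : ∀ b k → geometric b k *ₚ qint b ≈ₚ qint (k ℕ.* b)
  geometric-qint b zero    i = refl
  geometric-qint b (suc k) = begin
    (one +ₚ shift b (geometric b k)) *ₚ qint b       ≈⟨ *ₚ-distribʳ one (shift b (geometric b k)) (qint b) ⟩
    one *ₚ qint b +ₚ shift b (geometric b k) *ₚ qint b
      ≈⟨ +ₚ-cong (one *ₚ qint b) (qint b) (shift b (geometric b k) *ₚ qint b) (shift b (qint (k ℕ.* b)))
           (*ₚ-identityˡ (qint b))
           (λ i → trans (shift-*ₚ b (geometric b k) (qint b) i)
                        (shift-cong b (geometric b k *ₚ qint b) (qint (k ℕ.* b)) (geometric-qint b k) i)) ⟩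
    qint b +ₚ shift b (qint (k ℕ.* b))               ≈⟨ qint-+ b (k ℕ.* b) ⟨
    qint (b ℕ.+ k ℕ.* b)                             ∎

  qint-∣ₚ : ∀ {a m} → a ∣ m → qint a ∣ₚ qint m
  qint-∣ₚ {a} (divides k refl) = geometric a k witnesses λ i →
    trans (*ₚ-comm (qint a) (geometric a k) i) (geometric-qint a k i)

  -- a | b + 12t, decided for literal a and b.
  periodic-∣ : ∀ a b t → {True (a ∣? b)} → {True (a ∣? 12)} → a ∣ b ℕ.+ t ℕ.* 12
  periodic-∣ a b t {a∣b} {a∣12} = ∣m∣n⇒∣m+n (toWitness a∣b) (∣-trans (toWitness a∣12) (n∣m*n t))

  -- Cyclotomic factors: [6] = [2][3](1 - q + q²) and [12] = [3][4](1 - q + q³ - q⁵ + q⁶).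
  [2][3]∣[6] : qint 2 *ₚ qint 3 ∣ₚ qint 6
  [2][3]∣[6] = (+ 1 ∷ -[1+ 0 ] ∷ + 1 ∷ []) witnesses λ i → refl

  [3][4]∣[12] : qint 3 *ₚ qint 4 ∣ₚ qint 12
  [3][4]∣[12] = (+ 1 ∷ -[1+ 0 ] ∷ + 0 ∷ + 1 ∷ + 0 ∷ -[1+ 0 ] ∷ + 1 ∷ []) witnesses λ i → refl

  divisible-by-factors : ∀ a₀ a₁ a₂ a₃ {P₀ P₁ P₂ P₃} →
    P₀ ∣ₚ qint a₀ → P₁ ∣ₚ qint a₁ → P₂ ∣ₚ qint a₂ → P₃ ∣ₚ qint a₃ →
    P₀ *ₚ (P₁ *ₚ (P₂ *ₚ P₃)) ≈ₚ qint 2 *ₚ (qint 3 *ₚ qint 4) →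
    Σ Poly (λ X → qprod (2 ∷ 3 ∷ 4 ∷ []) X ≈ₚ qprod (a₀ ∷ a₁ ∷ a₂ ∷ a₃ ∷ []) one)
  divisible-by-factors a₀ a₁ a₂ a₃ {P₀} {P₁} {P₂} {P₃}
    (R₀ witnesses e₀) (R₁ witnesses e₁) (R₂ witnesses e₂) (R₃ witnesses e₃) divisors = X , (begin
    qint 2 *ₚ (qint 3 *ₚ (qint 4 *ₚ X))
      ≈⟨ prove 4 (v₀ ⊕ (v₁ ⊕ (v₂ ⊕ v₃))) ((v₀ ⊕ (v₁ ⊕ v₂)) ⊕ v₃) (qint 2 ∷ qint 3 ∷ qint 4 ∷ X ∷ []) ⟩
    (qint 2 *ₚ (qint 3 *ₚ qint 4)) *ₚ X
      ≈⟨ *ₚ-congˡ (qint 2 *ₚ (qint 3 *ₚ qint 4)) (P₀ *ₚ (P₁ *ₚ (P₂ *ₚ P₃))) X (λ i → sym (divisors i)) ⟩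
    (P₀ *ₚ (P₁ *ₚ (P₂ *ₚ P₃))) *ₚ X
      ≈⟨ prove 8 ((v₀ ⊕ (v₁ ⊕ (v₂ ⊕ v₃))) ⊕ (v₄ ⊕ (v₅ ⊕ (v₆ ⊕ v₇))))
                 ((v₀ ⊕ v₄) ⊕ ((v₁ ⊕ v₅) ⊕ ((v₂ ⊕ v₆) ⊕ (v₃ ⊕ v₇))))
                 (P₀ ∷ P₁ ∷ P₂ ∷ P₃ ∷ R₀ ∷ R₁ ∷ R₂ ∷ R₃ ∷ []) ⟩
    (P₀ *ₚ R₀) *ₚ ((P₁ *ₚ R₁) *ₚ ((P₂ *ₚ R₂) *ₚ (P₃ *ₚ R₃)))
      ≈⟨ *ₚ-cong (P₀ *ₚ R₀) (qint a₀) _ _ e₀ (*ₚ-cong (P₁ *ₚ R₁) (qint a₁) _ _ e₁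
           (*ₚ-cong (P₂ *ₚ R₂) (qint a₂) (P₃ *ₚ R₃) (qint a₃) e₂ e₃)) ⟩
    qint a₀ *ₚ (qint a₁ *ₚ (qint a₂ *ₚ qint a₃))
      ≈⟨ prove 4 (v₀ ⊕ (v₁ ⊕ (v₂ ⊕ v₃))) (v₀ ⊕ (v₁ ⊕ (v₂ ⊕ (v₃ ⊕ id)))) (qint a₀ ∷ qint a₁ ∷ qint a₂ ∷ qint a₃ ∷ []) ⟩
    qprod (a₀ ∷ a₁ ∷ a₂ ∷ a₃ ∷ []) one ∎)
    where
    X : Poly
    X = R₀ *ₚ (R₁ *ₚ (R₂ *ₚ R₃))
    v₀ : ∀ {k} → Expr (1 ℕ.+ k)
    v₀ = var zero
    v₁ : ∀ {k} → Expr (2 ℕ.+ k)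
    v₁ = var (suc zero)
    v₂ : ∀ {k} → Expr (3 ℕ.+ k)
    v₂ = var (suc (suc zero))
    v₃ : ∀ {k} → Expr (4 ℕ.+ k)
    v₃ = var (suc (suc (suc zero)))
    v₄ v₅ v₆ v₇ : Expr 8
    v₄ = var (suc (suc (suc (suc zero))))
    v₅ = var (suc (suc (suc (suc (suc zero)))))
    v₆ = var (suc (suc (suc (suc (suc (suc zero))))))
    v₇ = var (suc (suc (suc (suc (suc (suc (suc zero)))))))

  gcd-shift : ∀ m r k → m ∣ k → gcd m (r ℕ.+ k) ≡ gcd m r
  gcd-shift m r k m∣k = ∣-antisym (gcd-greatest (gcd[m,n]∣m m (r ℕ.+ k)) g′∣r) (gcd-greatest (gcd[m,n]∣m m r) g∣r+k)
    where
    g′∣r : gcd m (r ℕ.+ k) ∣ r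
    g′∣r = ∣m+n∣m⇒∣n (subst (gcd m (r ℕ.+ k) ∣_) (ℕP.+-comm r k) (gcd[m,n]∣n m (r ℕ.+ k)))
                     (∣-trans (gcd[m,n]∣m m (r ℕ.+ k)) m∣k)
    g∣r+k : gcd m r ∣ r ℕ.+ k
    g∣r+k = ∣m∣n⇒∣m+n (gcd[m,n]∣n m r) (∣-trans (gcd[m,n]∣m m r) m∣k)

  [_]∣[_+12_] : ∀ a b t → {True (a ∣? b)} → {True (a ∣? 12)} → qint a ∣ₚ qint (b ℕ.+ t ℕ.* 12)
  [ a ]∣[ b +12 t ] {a∣b} {a∣12} = qint-∣ₚ (periodic-∣ a b t {a∣b} {a∣12})

  [2][3]∣[_+12_] : ∀ b t → {True (6 ∣? b)} → qint 2 *ₚ qint 3 ∣ₚ qint (b ℕ.+ t ℕ.* 12)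
  [2][3]∣[ b +12 t ] {6∣b} = ∣ₚ-trans [2][3]∣[6] ([ 6 ]∣[ b +12 t ] {6∣b})

  [3][4]∣[_+12_] : ∀ b t → {True (12 ∣? b)} → qint 3 *ₚ qint 4 ∣ₚ qint (b ℕ.+ t ℕ.* 12)
  [3][4]∣[ b +12 t ] {12∣b} = ∣ₚ-trans [3][4]∣[12] ([ 12 ]∣[ b +12 t ] {12∣b})

  q₂ q₃ q₄ target : Expr 3
  q₂ = var zero
  q₃ = var (suc zero)
  q₄ = var (suc (suc zero))
  target = q₂ ⊕ (q₃ ⊕ q₄)

  ρ : Data.Vec.Vec Poly 3
  ρ = qint 2 ∷ qint 3 ∷ qint 4 ∷ []

  -- Case analysis on n mod 12: each of 2, 3, 4 (or 6 = 2·3, 12 = 3·4) divides a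
  -- different one of gcd(4, n), n + 1, n + 2, n + 3.
  quotient-by-residue : ∀ r t → r ℕ.< 12 →
    Σ Poly (λ X → qprod (2 ∷ 3 ∷ 4 ∷ []) X ≈ₚ qprod (gcd 4 r ∷ steps (r ℕ.+ t ℕ.* 12)) one)
  quotient-by-residue 0 t _ =
    divisible-by-factors 4 (1 ℕ.+ t ℕ.* 12) (2 ℕ.+ t ℕ.* 12) (3 ℕ.+ t ℕ.* 12)
      (∣ₚ-refl _) (one-∣ₚ _) [ 2 ]∣[ 2 +12 t ] [ 3 ]∣[ 3 +12 t ]
      (prove 3 (q₄ ⊕ (id ⊕ (q₂ ⊕ q₃))) target ρ)
  quotient-by-residue 1 t _ =
    divisible-by-factors 1 (2 ℕ.+ t ℕ.* 12) (3 ℕ.+ t ℕ.* 12) (4 ℕ.+ t ℕ.* 12)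
      (one-∣ₚ _) [ 2 ]∣[ 2 +12 t ] [ 3 ]∣[ 3 +12 t ] [ 4 ]∣[ 4 +12 t ]
      (prove 3 (id ⊕ (q₂ ⊕ (q₃ ⊕ q₄))) target ρ)
  quotient-by-residue 2 t _ =
    divisible-by-factors 2 (3 ℕ.+ t ℕ.* 12) (4 ℕ.+ t ℕ.* 12) (5 ℕ.+ t ℕ.* 12)
      (∣ₚ-refl _) [ 3 ]∣[ 3 +12 t ] [ 4 ]∣[ 4 +12 t ] (one-∣ₚ _)
      (prove 3 (q₂ ⊕ (q₃ ⊕ (q₄ ⊕ id))) target ρ)
  quotient-by-residue 3 t _ =
    divisible-by-factors 1 (4 ℕ.+ t ℕ.* 12) (5 ℕ.+ t ℕ.* 12) (6 ℕ.+ t ℕ.* 12)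
      (one-∣ₚ _) [ 4 ]∣[ 4 +12 t ] (one-∣ₚ _) [2][3]∣[ 6 +12 t ]
      (prove 3 (id ⊕ (q₄ ⊕ (id ⊕ (q₂ ⊕ q₃)))) target ρ)
  quotient-by-residue 4 t _ =
    divisible-by-factors 4 (5 ℕ.+ t ℕ.* 12) (6 ℕ.+ t ℕ.* 12) (7 ℕ.+ t ℕ.* 12)
      (∣ₚ-refl _) (one-∣ₚ _) [2][3]∣[ 6 +12 t ] (one-∣ₚ _)
      (prove 3 (q₄ ⊕ (id ⊕ ((q₂ ⊕ q₃) ⊕ id))) target ρ)
  quotient-by-residue 5 t _ =
    divisible-by-factors 1 (6 ℕ.+ t ℕ.* 12) (7 ℕ.+ t ℕ.* 12) (8 ℕ.+ t ℕ.* 12)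
      (one-∣ₚ _) [2][3]∣[ 6 +12 t ] (one-∣ₚ _) [ 4 ]∣[ 8 +12 t ]
      (prove 3 (id ⊕ ((q₂ ⊕ q₃) ⊕ (id ⊕ q₄))) target ρ)
  quotient-by-residue 6 t _ =
    divisible-by-factors 2 (7 ℕ.+ t ℕ.* 12) (8 ℕ.+ t ℕ.* 12) (9 ℕ.+ t ℕ.* 12)
      (∣ₚ-refl _) (one-∣ₚ _) [ 4 ]∣[ 8 +12 t ] [ 3 ]∣[ 9 +12 t ]
      (prove 3 (q₂ ⊕ (id ⊕ (q₄ ⊕ q₃))) target ρ)
  quotient-by-residue 7 t _ =
    divisible-by-factors 1 (8 ℕ.+ t ℕ.* 12) (9 ℕ.+ t ℕ.* 12) (10 ℕ.+ t ℕ.* 12)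
      (one-∣ₚ _) [ 4 ]∣[ 8 +12 t ] [ 3 ]∣[ 9 +12 t ] [ 2 ]∣[ 10 +12 t ]
      (prove 3 (id ⊕ (q₄ ⊕ (q₃ ⊕ q₂))) target ρ)
  quotient-by-residue 8 t _ =
    divisible-by-factors 4 (9 ℕ.+ t ℕ.* 12) (10 ℕ.+ t ℕ.* 12) (11 ℕ.+ t ℕ.* 12)
      (∣ₚ-refl _) [ 3 ]∣[ 9 +12 t ] [ 2 ]∣[ 10 +12 t ] (one-∣ₚ _)
      (prove 3 (q₄ ⊕ (q₃ ⊕ (q₂ ⊕ id))) target ρ)
  quotient-by-residue 9 t _ =
    divisible-by-factors 1 (10 ℕ.+ t ℕ.* 12) (11 ℕ.+ t ℕ.* 12) (12 ℕ.+ t ℕ.* 12)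
      (one-∣ₚ _) [ 2 ]∣[ 10 +12 t ] (one-∣ₚ _) [3][4]∣[ 12 +12 t ]
      (prove 3 (id ⊕ (q₂ ⊕ (id ⊕ (q₃ ⊕ q₄)))) target ρ)
  quotient-by-residue 10 t _ =
    divisible-by-factors 2 (11 ℕ.+ t ℕ.* 12) (12 ℕ.+ t ℕ.* 12) (13 ℕ.+ t ℕ.* 12)
      (∣ₚ-refl _) (one-∣ₚ _) [3][4]∣[ 12 +12 t ] (one-∣ₚ _)
      (prove 3 (q₂ ⊕ (id ⊕ ((q₃ ⊕ q₄) ⊕ id))) target ρ)
  quotient-by-residue 11 t _ =
    divisible-by-factors 1 (12 ℕ.+ t ℕ.* 12) (13 ℕ.+ t ℕ.* 12) (14 ℕ.+ t ℕ.* 12)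
      (one-∣ₚ _) [3][4]∣[ 12 +12 t ] (one-∣ₚ _) [ 2 ]∣[ 14 +12 t ]
      (prove 3 (id ⊕ ((q₃ ⊕ q₄) ⊕ (id ⊕ q₂))) target ρ)

  quotient-by-residue (suc (suc (suc (suc (suc (suc (suc (suc (suc (suc (suc (suc r)))))))))))) t
    (s≤s (s≤s (s≤s (s≤s (s≤s (s≤s (s≤s (s≤s (s≤s (s≤s (s≤s (s≤s ()))))))))))))

  catalan-quotient : ∀ n → Σ Poly (λ X → qprod (2 ∷ 3 ∷ 4 ∷ []) X ≈ₚ qprod (gcd 4 n ∷ steps n) one)
  catalan-quotient n = subst Quotient (sym (m≡m%n+[m/n]*n n 12))
    (subst (λ d → Σ Poly (λ X → qprod (2 ∷ 3 ∷ 4 ∷ []) X ≈ₚ qprod (d ∷ steps r+12t) one))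
           (sym (gcd-shift 4 (n % 12) ((n / 12) ℕ.* 12) (∣-trans (divides 3 refl) (n∣m*n (n / 12)))))
           (quotient-by-residue (n % 12) (n / 12) (m%n<n n 12)))
    where
    r+12t : ℕ
    r+12t = n % 12 ℕ.+ (n / 12) ℕ.* 12
    Quotient : ℕ → Set
    Quotient m = Σ Poly (λ X → qprod (2 ∷ 3 ∷ 4 ∷ []) X ≈ₚ qprod (gcd 4 m ∷ steps m) one)

open PolynomialAlgebra using (one)
open CoefficientSeries using (qprod)
open CatalanIdentity using (steps)
open CoreArgument using (Dominating; module ParityUnimodality)
open DominatingSeries using (dominating₁; dominating₂; dominating₄)
open CatalanQuotient using (catalan-quotient; gcd-shift)
open import Data.Nat as ℕ using (suc; s≤s; z≤n; _<_)
open import Data.Nat.DivMod using (_%_; _/_; m≡m%n+[m/n]*n; m%n<n)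
open import Data.Nat.Divisibility using (n∣m*n)
open import Data.Nat.Solver using (module +-*-Solver)
open +-*-Solver using (solve; _:+_; _:*_; con; _:=_)
open import Data.List using ([]; _∷_)
open import Data.Product using (_,_)
open import Relation.Binary.PropositionalEquality using (_≡_; refl; sym; subst)

-- What depends on n mod 4: d = gcd(4, n) = d′ + 1, the degree 2c = 3n + d′ - 3
-- of [d] C_{4,n}, and the dominating series for [d].
record Parameters (n : ℕ) : Set where
  field
    d′ c       : ℕ
    gcd≡       : gcd 4 n ≡ suc d′
    balance    : c ℕ.+ c ℕ.+ 3 ≡ n ℕ.+ n ℕ.+ n ℕ.+ d′
    d′≤3       : d′ ≤ 3
    dominating : Dominating d′

parameters-by-residue : ∀ r t → r < 4 → Parameters (r ℕ.+ t ℕ.* 4)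
parameters-by-residue 0 t _ = record
  { d′ = 3 ; c = t ℕ.* 6 ; gcd≡ = gcd-shift 4 0 (t ℕ.* 4) (n∣m*n t)
  ; balance = solve 1 (λ t → t :* con 6 :+ t :* con 6 :+ con 3 := t :* con 4 :+ t :* con 4 :+ t :* con 4 :+ con 3) refl t
  ; d′≤3 = s≤s (s≤s (s≤s z≤n)) ; dominating = dominating₄ }
parameters-by-residue 1 t _ = record
  { d′ = 0 ; c = t ℕ.* 6 ; gcd≡ = gcd-shift 4 1 (t ℕ.* 4) (n∣m*n t)
  ; balance = solve 1 (λ t → t :* con 6 :+ t :* con 6 :+ con 3
                            := (con 1 :+ t :* con 4) :+ (con 1 :+ t :* con 4) :+ (con 1 :+ t :* con 4) :+ con 0) refl t
  ; d′≤3 = z≤n ; dominating = dominating₁ }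
parameters-by-residue 2 t _ = record
  { d′ = 1 ; c = 2 ℕ.+ t ℕ.* 6 ; gcd≡ = gcd-shift 4 2 (t ℕ.* 4) (n∣m*n t)
  ; balance = solve 1 (λ t → (con 2 :+ t :* con 6) :+ (con 2 :+ t :* con 6) :+ con 3
                            := (con 2 :+ t :* con 4) :+ (con 2 :+ t :* con 4) :+ (con 2 :+ t :* con 4) :+ con 1) refl t
  ; d′≤3 = s≤s z≤n ; dominating = dominating₂ }
parameters-by-residue 3 t _ = record
  { d′ = 0 ; c = 3 ℕ.+ t ℕ.* 6 ; gcd≡ = gcd-shift 4 3 (t ℕ.* 4) (n∣m*n t)
  ; balance = solve 1 (λ t → (con 3 :+ t :* con 6) :+ (con 3 :+ t :* con 6) :+ con 3
                            := (con 3 :+ t :* con 4) :+ (con 3 :+ t :* con 4) :+ (con 3 :+ t :* con 4) :+ con 0) refl t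
  ; d′≤3 = z≤n ; dominating = dominating₁ }
parameters-by-residue (suc (suc (suc (suc r)))) t (s≤s (s≤s (s≤s (s≤s ()))))

parameters : ∀ n → Parameters n
parameters n =
  subst Parameters (sym (m≡m%n+[m/n]*n n 4)) (parameters-by-residue (n % 4) (n / 4) (m%n<n n 4))

-- Combining the quotient X from CatalanQuotient with the parameters for n mod 4.
-- The statement holds for every n, including n = 0 (where the polynomial is 1).
scaled-catalan-unimodal : ∀ n →
  Σ Poly (λ P → Normalized P × IsScaledQCatalan (gcd 4 n) 4 n P × UnimodalWrtParity P)
scaled-catalan-unimodal n with catalan-quotient n
... | X , product = subst (λ d → Σ Poly (λ P → Normalized P × IsScaledQCatalan d 4 n P × UnimodalWrtParity P))
                          (sym gcd≡)
                          (ParityUnimodality.result n d′ c X product′ balance d′≤3 dominating)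
  where
  open Parameters (parameters n)
  product′ : qprod (2 ∷ 3 ∷ 4 ∷ []) X ≈ₚ qprod (suc d′ ∷ steps n) one
  product′ = subst (λ d → qprod (2 ∷ 3 ∷ 4 ∷ []) X ≈ₚ qprod (d ∷ steps n) one) gcd≡ product

proposition8 : (n : ℕ) → 1 ≤ n →
    Σ Poly (λ P → Normalized P × IsScaledQCatalan (gcd 4 n) 4 n P × UnimodalWrtParity P)
proposition8 n _ = scaled-catalan-unimodal n
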